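{- Let $G$ be a non-trivial connected graph on $n$ vertices, with $e(G)$ edges and diameter $\mathrm{diam}(G)$. (a) $\mathrm{diam}(G)\le rc(G)\le rc^\ell(G)\le n-1$, and $\mathrm{diam}(G)\le rc(G)\le src(G)\le src^\ell(G)\le e(G)$. (b) If $G$ has $p$ bridges, then $rc(G)\ge p$. (c) If $v$ is a cut-vertex of $G$ such that $G-v$ has $q\ge 2$ components, then $src(G)\ge q$. (d) If $n\ge 3$ and $w$ is a pendent vertex (vertex of degree $1$) of $G$, then $rc(G)\ge rc(G-w)$ and $src(G)\ge src(G-w)$. (e) The following are equivalent: (i) $G$ is a complete graph; (ii) $\mathrm{diam}(G)=1$; (iii) $rc(G)=1$; (iv) $src(G)=1$; (v) $rc^\ell(G)=1$; (vi) $src^\ell(G)=1$. (f) $rc(G)=2$ if and only if $src(G)=2$. Moreover, $src^\ell(G)=2$ implies $rc^\ell(G)=2$, which in turn implies both $rc(G)=2$ and $src(G)=2$. (g) The following are equivalent: (i) $G$ is a tree; (ii) $rc(G)=e(G)$; (iii) $src(G)=e(G)$; (iv) $rc^\ell(G)=e(G)$; (v) $src^\ell(G)=e(G)$.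
   Context: All graphs are finite, simple and undirected. An edge-colouring of a graph need not be proper. An edge-coloured path is rainbow if all its edges have distinct colours. A geodesic between two vertices is a path between them of shortest possible length. An edge-colouring of a connected graph $G$ is rainbow connected (resp. strongly rainbow connected) if any two vertices are joined by a rainbow path (resp. a rainbow geodesic). $rc(G)$ (resp. $src(G)$) is the minimum number of colours in a rainbow connected (resp. strongly rainbow connected) edge-colouring of $G$. An $r$-edge-list assignment of $G$ is a function $L$ assigning to each edge $e$ a set $L(e)\subset\mathbb N$ with $|L(e)|\ge r$; an $L$-edge-colouring is an edge-colouring $c$ with $c(e)\in L(e)$ for all edges $e$. The list rainbow connection number $rc^\ell(G)$ (resp. list strong rainbow connection number $src^\ell(G)$) is the minimum integer $r$ such that for every $r$-edge-list assignment $L$ of $G$ there is an $L$-edge-colouring of $G$ that is rainbow connected (resp. strongly rainbow connected). -}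

module Defs where

open import Data.Nat using (ℕ; zero; suc; pred; _≤_; _<_; _∸_)
open import Data.Nat.Properties using (_<?_)
open import Data.Fin using (Fin; toℕ; punchIn) renaming (_≟_ to _≟ᶠ_)
open import Data.Bool using (Bool; true; false; _∧_; not)
open import Data.List using (List; []; _∷_; length; map; filter; concatMap; allFin)
open import Data.List.Membership.Propositional using (_∈_)
open import Data.List.Relation.Unary.Unique.Propositional using (Unique)
open import Data.Product using (Σ; ∃; _×_; _,_)
open import Relation.Nullary using (¬_; yes; no)
open import Relation.Binary.PropositionalEquality using (_≡_; _≢_; refl)

record Graph (n : ℕ) : Set where
  field
    adj    : Fin n → Fin n → Bool
    sym    : ∀ i j → adj i j ≡ adj j i
    irrefl : ∀ i → adj i i ≡ false
open Graph public

Edge : ∀ {n} → Graph n → Fin n → Fin n → Set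
Edge G i j = adj G i j ≡ true

data Walk {n : ℕ} (A : Fin n → Fin n → Bool) : Fin n → Fin n → Set where
  nil  : ∀ {u} → Walk A u u
  cons : ∀ {u w v} → A u w ≡ true → Walk A w v → Walk A u v

verts : ∀ {n} {A : Fin n → Fin n → Bool} {u v} → Walk A u v → List (Fin n)
verts {u = u} nil = u ∷ []
verts (cons {u = u} _ p) = u ∷ verts p

len : ∀ {n} {A : Fin n → Fin n → Bool} {u v} → Walk A u v → ℕ
len nil = 0
len (cons _ p) = suc (len p)

IsPath : ∀ {n} {A : Fin n → Fin n → Bool} {u v} → Walk A u v → Set
IsPath p = Unique (verts p)

edgeColours : ∀ {n} {A : Fin n → Fin n → Bool} {u v} →
              (Fin n → Fin n → ℕ) → Walk A u v → List ℕ
edgeColours c nil = []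
edgeColours c (cons {u = u} {w = w} _ p) = c u w ∷ edgeColours c p

Rainbow : ∀ {n} {A : Fin n → Fin n → Bool} {u v} →
          (Fin n → Fin n → ℕ) → Walk A u v → Set
Rainbow c p = Unique (edgeColours c p)

Geodesic : ∀ {n} {A : Fin n → Fin n → Bool} {u v} → Walk A u v → Set
Geodesic {A = A} {u} {v} p = IsPath p × (∀ (q : Walk A u v) → IsPath q → len p ≤ len q)

ConnectedAdj : ∀ {n} → (Fin n → Fin n → Bool) → Set
ConnectedAdj {n} A = ∀ (u v : Fin n) → Walk A u v

Connected : ∀ {n} → Graph n → Set
Connected G = ConnectedAdj (adj G)

IsDist : ∀ {n} → Graph n → Fin n → Fin n → ℕ → Set
IsDist G u v d =
  Σ (Walk (adj G) u v) (λ p → IsPath p × len p ≡ d) ×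
  (∀ (q : Walk (adj G) u v) → IsPath q → d ≤ len q)

IsDiam : ∀ {n} → Graph n → ℕ → Set
IsDiam {n} G D =
  (∀ (u v : Fin n) → ∃ λ d → IsDist G u v d × d ≤ D) ×
  ∃ λ u → ∃ λ v → IsDist G u v D

-- edges listed as pairs (i , j) with i < j
edgeList : ∀ {n} → Graph n → List (Fin n × Fin n)
edgeList {n} G =
  concatMap (λ i → map (λ j → (i , j))
     (filter (λ j → toℕ i <? toℕ j)
       (filter (λ j → adj G i j Data.Bool.≟ true) (allFin n))))
     (allFin n)
  where import Data.Bool

e : ∀ {n} → Graph n → ℕ
e G = length (edgeList G)

degree : ∀ {n} → Graph n → Fin n → ℕ
degree {n} G v = length (filter (λ j → adj G v j Data.Bool.≟ true) (allFin n))
  where import Data.Bool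

Complete : ∀ {n} → Graph n → Set
Complete {n} G = ∀ (i j : Fin n) → i ≢ j → Edge G i j

HasCycle : ∀ {n} → Graph n → Set
HasCycle {n} G =
  ∃ λ (u : Fin n) → ∃ λ (v : Fin n) → Σ (Walk (adj G) u v) λ p →
    IsPath p × 2 ≤ len p × Edge G v u

IsTree : ∀ {n} → Graph n → Set
IsTree G = Connected G × ¬ HasCycle G

delEdgeAdj : ∀ {n} → Graph n → Fin n → Fin n → Fin n → Fin n → Bool
delEdgeAdj G i j a b with a ≟ᶠ i | b ≟ᶠ j | a ≟ᶠ j | b ≟ᶠ i
... | yes _ | yes _ | _ | _ = false
... | _ | _ | yes _ | yes _ = false
... | _ | _ | _ | _ = adj G a b

IsBridge : ∀ {n} → Graph n → Fin n → Fin n → Set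
IsBridge G i j = Edge G i j × ¬ ConnectedAdj (delEdgeAdj G i j)

HasBridges : ∀ {n} → Graph n → ℕ → Set
HasBridges {n} G p =
  Σ (List (Fin n × Fin n)) λ bs →
    Unique bs × length bs ≡ p ×
    (∀ {i j} → (i , j) ∈ bs → toℕ i < toℕ j × IsBridge G i j) ×
    (∀ i j → toℕ i < toℕ j → IsBridge G i j → (i , j) ∈ bs)

-- G - v, with vertices relabelled by punchIn v
removeVertex : ∀ {n} → Graph n → Fin n → Graph (pred n)
removeVertex {suc m} G v = record
  { adj    = λ a b → adj G (punchIn v a) (punchIn v b)
  ; sym    = λ a b → sym G (punchIn v a) (punchIn v b)
  ; irrefl = λ a → irrefl G (punchIn v a)
  }

-- G has exactly q connected components: a surjection onto Fin q whose
-- fibres are exactly the classes of the "joined by a walk" relation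
HasComponents : ∀ {n} → Graph n → ℕ → Set
HasComponents {n} G q =
  Σ (Fin n → Fin q) λ comp →
    (∀ (y : Fin q) → ∃ λ x → comp x ≡ y) ×
    (∀ (x y : Fin n) → (comp x ≡ comp y → Walk (adj G) x y) × (Walk (adj G) x y → comp x ≡ comp y))

-- a function on ordered pairs that is symmetric on edges represents a
-- function on the (unordered) edges
SymOnEdges : ∀ {n} {X : Set} → Graph n → (Fin n → Fin n → X) → Set
SymOnEdges {n} G f = ∀ (i j : Fin n) → Edge G i j → f i j ≡ f j i

RainbowConnected : ∀ {n} → Graph n → (Fin n → Fin n → ℕ) → Set
RainbowConnected {n} G c =
  ∀ (u v : Fin n) → Σ (Walk (adj G) u v) λ p → IsPath p × Rainbow c p

StronglyRainbowConnected : ∀ {n} → Graph n → (Fin n → Fin n → ℕ) → Set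
StronglyRainbowConnected {n} G c =
  ∀ (u v : Fin n) → Σ (Walk (adj G) u v) λ p → Geodesic p × Rainbow c p

UsesColours : ∀ {n} → Graph n → ℕ → (Fin n → Fin n → ℕ) → Set
UsesColours {n} G k c = SymOnEdges G c × (∀ (i j : Fin n) → Edge G i j → c i j < k)

RC : ∀ {n} → Graph n → ℕ → Set
RC {n} G k = Σ (Fin n → Fin n → ℕ) λ c → UsesColours G k c × RainbowConnected G c

SRC : ∀ {n} → Graph n → ℕ → Set
SRC {n} G k = Σ (Fin n → Fin n → ℕ) λ c → UsesColours G k c × StronglyRainbowConnected G c

ListAssignment : ∀ {n} → Graph n → ℕ → (Fin n → Fin n → List ℕ) → Set
ListAssignment {n} G r L =
  SymOnEdges G L × (∀ (i j : Fin n) → Edge G i j → Unique (L i j) × r ≤ length (L i j))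

LColouring : ∀ {n} → Graph n → (Fin n → Fin n → List ℕ) → (Fin n → Fin n → ℕ) → Set
LColouring {n} G L c = SymOnEdges G c × (∀ (i j : Fin n) → Edge G i j → c i j ∈ L i j)

RCL : ∀ {n} → Graph n → ℕ → Set
RCL {n} G r = ∀ (L : Fin n → Fin n → List ℕ) → ListAssignment G r L →
  Σ (Fin n → Fin n → ℕ) λ c → LColouring G L c × RainbowConnected G c

SRCL : ∀ {n} → Graph n → ℕ → Set
SRCL {n} G r = ∀ (L : Fin n → Fin n → List ℕ) → ListAssignment G r L →
  Σ (Fin n → Fin n → ℕ) λ c → LColouring G L c × StronglyRainbowConnected G c

IsMin : (ℕ → Set) → ℕ → Set
IsMin P k = P k × (∀ j → P j → k ≤ j)

rc≡ src≡ rcℓ≡ srcℓ≡ : ∀ {n} → Graph n → ℕ → Set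
rc≡ G = IsMin (RC G)
src≡ G = IsMin (SRC G)
rcℓ≡ G = IsMin (RCL G)
srcℓ≡ G = IsMin (SRCL G)

{-# OPTIONS --safe #-}
module Submission where

-- Lower bounds come from forcing distinct colours: a rainbow path joining the far ends of two bridges
-- crosses both; the neighbours of a cut vertex v in different components of G − v are joined only by
-- geodesics through v.  Upper bounds come from greedy list colourings: colouring the edges of a spanning
-- tree, grown one vertex at a time, with fresh colours gives n − 1; giving all edges distinct colours makes
-- every geodesic rainbow.  If G has a cycle, cut it at two opposite edges into arcs of almost equal length.
-- When two ends of these edges are closer in G than along the cycle, a shorter cycle appears; otherwise a
-- geodesic using both edges would contain a piece longer than an arc between the same ends, so the two
-- edges may share a colour and lists of size e(G) − 1 suffice.  In a tree every edge is a bridge.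

open import Defs hiding (sym)
open import Data.Nat using (ℕ; zero; suc; pred; _+_; _≤_; _<_; _∸_; z≤n; s≤s; ⌊_/2⌋; ⌈_/2⌉)
open import Data.Nat.Properties renaming (_≟_ to _≟ℕ_)
open import Data.Nat.Induction using (<-wellFounded)
open import Data.Fin using (Fin; toℕ; punchIn; punchOut) renaming (_≟_ to _≟ᶠ_)
import Data.Fin.Properties as Finₚ
open import Data.Bool using (Bool; true; false; not) renaming (_≟_ to _≟ᵇ_)
open import Data.Bool.Properties using (not-involutive)
open import Data.List using (List; []; _∷_; [_]; length; map; filter; _++_; upTo; allFin)
open import Data.List.Properties using (length-++; length-map; length-upTo; length-tabulate; map-++; map-id; map-cong-local)
open import Data.List.Membership.Propositional using (_∈_; _∉_; find; lose)
open import Data.List.Membership.Propositional.Properties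
open import Data.List.Relation.Binary.Subset.Propositional using (_⊆_)
open import Data.List.Relation.Unary.Any using (here; there)
open import Data.List.Relation.Unary.All as All using (All; []; _∷_; all?)
import Data.List.Relation.Unary.All.Properties as Allₚ
open import Data.List.Relation.Unary.AllPairs as AllPairs using ([]; _∷_)
import Data.List.Relation.Unary.AllPairs.Properties as AllPairsₚ
open import Data.List.Relation.Unary.Unique.Propositional using (Unique)
import Data.List.Relation.Unary.Unique.Propositional.Properties as Uniqueₚ
open import Data.Product using (Σ; ∃; _×_; _,_; proj₁; proj₂; uncurry)
open import Data.Product.Properties using (≡-dec)
open import Data.Sum using (_⊎_; inj₁; inj₂)
open import Data.Empty using (⊥; ⊥-elim)
open import Function using (_∘_; _⇔_; mk⇔; case_of_)
open import Induction.WellFounded using (Acc; acc)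
open import Relation.Nullary using (¬_; yes; no; Dec; contradiction; _×-dec_; _⊎-dec_; ¬?)
open import Relation.Nullary.Decidable using (decidable-stable)
open import Relation.Binary.Definitions using (DecidableEquality)
open import Relation.Binary.PropositionalEquality using (_≡_; _≢_; refl; sym; trans; cong; cong₂; subst; subst₂; module ≡-Reasoning)

module _ {A : Set} where

  unique⊆⇒length≤ : ∀ {xs ys : List A} → Unique xs → xs ⊆ ys → length xs ≤ length ys
  unique⊆⇒length≤ {[]} _ _ = z≤n
  unique⊆⇒length≤ {x ∷ xs} {ys} (x∉xs ∷ !xs) xs⊆ys with ∈-∃++ (xs⊆ys (here refl))
  ... | as , bs , refl = begin
    suc (length xs)         ≤⟨ s≤s (unique⊆⇒length≤ !xs xs⊆as++bs) ⟩
    suc (length (as ++ bs)) ≡⟨ cong suc (length-++ as) ⟩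
    suc (length as + length bs) ≡⟨ +-suc (length as) (length bs) ⟨
    length as + length (x ∷ bs) ≡⟨ length-++ as ⟨
    length (as ++ x ∷ bs)   ∎
    where
    open ≤-Reasoning
    xs⊆as++bs : xs ⊆ as ++ bs
    xs⊆as++bs {y} y∈xs with ∈-++⁻ as (xs⊆ys (there y∈xs))
    ... | inj₁ y∈as         = ∈-++⁺ˡ y∈as
    ... | inj₂ (here refl)  = contradiction refl (All.lookup x∉xs y∈xs)
    ... | inj₂ (there y∈bs) = ∈-++⁺ʳ as y∈bs

  module _ (_≟_ : DecidableEquality A) where
    open import Data.List.Membership.DecPropositional _≟_ using (_∈?_)

    ∃-∈-∉ : ∀ {xs ys : List A} → Unique xs → length ys < length xs → ∃ λ x → x ∈ xs × x ∉ ys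
    ∃-∈-∉ {xs} {ys} !xs ys<xs with all? (_∈? ys) xs
    ... | yes xs⊆ys = contradiction (unique⊆⇒length≤ !xs (All.lookup xs⊆ys)) (<⇒≱ ys<xs)
    ... | no  xs⊈ys = find (Allₚ.¬All⇒Any¬ (_∈? ys) xs xs⊈ys)

unique-Fin⇒length≤ : ∀ {n} {xs : List (Fin n)} → Unique xs → length xs ≤ n
unique-Fin⇒length≤ {n} {xs} !xs = subst (length xs ≤_) (length-tabulate {n = n} (λ i → i)) (unique⊆⇒length≤ !xs (λ {x} _ → ∈-allFin x))

head₀ : List ℕ → ℕ
head₀ []      = 0
head₀ (x ∷ _) = x

head₀∈ : ∀ {xs} → 0 < length xs → head₀ xs ∈ xs
head₀∈ {_ ∷ _} _ = here refl

infix 4 _≐_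
_≐_ : {A : Set} → A × A → A × A → Set
(a , b) ≐ (x , y) = (a ≡ x × b ≡ y) ⊎ (a ≡ y × b ≡ x)

module _ {A : Set} where

  ≐-sym : {p q : A × A} → p ≐ q → q ≐ p
  ≐-sym (inj₁ (refl , refl)) = inj₁ (refl , refl)
  ≐-sym (inj₂ (refl , refl)) = inj₂ (refl , refl)

  ≐-trans : {p q r : A × A} → p ≐ q → q ≐ r → p ≐ r
  ≐-trans (inj₁ (refl , refl)) q≐r                  = q≐r
  ≐-trans (inj₂ (refl , refl)) (inj₁ (refl , refl)) = inj₂ (refl , refl)
  ≐-trans (inj₂ (refl , refl)) (inj₂ (refl , refl)) = inj₁ (refl , refl)

  ≐-swapˡ : {a b : A} {q : A × A} → (a , b) ≐ q → (b , a) ≐ q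
  ≐-swapˡ (inj₁ (refl , refl)) = inj₂ (refl , refl)
  ≐-swapˡ (inj₂ (refl , refl)) = inj₁ (refl , refl)

  ≐-dec : DecidableEquality A → (p q : A × A) → Dec (p ≐ q)
  ≐-dec _≟_ (a , b) (x , y) = ((a ≟ x) ×-dec (b ≟ y)) ⊎-dec ((a ≟ y) ×-dec (b ≟ x))

module Update {A : Set} (_≟_ : DecidableEquality A) {B : Set} where

  _[_↦_] : (A → B) → A → B → A → B
  (f [ a ↦ b ]) x with x ≟ a
  ... | yes _ = b
  ... | no  _ = f x

  [↦]-≡ : ∀ f a b → (f [ a ↦ b ]) a ≡ b
  [↦]-≡ f a b with a ≟ a
  ... | yes _   = refl
  ... | no  a≢a = contradiction refl a≢a

  [↦]-≢ : ∀ f {a} b {x} → x ≢ a → (f [ a ↦ b ]) x ≡ f x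
  [↦]-≢ f {a} b {x} x≢a with x ≟ a
  ... | yes x≡a = contradiction x≡a x≢a
  ... | no  _   = refl

module _ {A : Set} (L : A → List ℕ) where

  Lists≥ : List A → ℕ → Set
  Lists≥ xs k = ∀ {x} → x ∈ xs → Unique (L x) × k ≤ length (L x)

  record DistinctChoice (xs : List A) (avoid : List ℕ) : Set where
    field
      choose        : A → ℕ
      choose∈       : ∀ {x} → x ∈ xs → choose x ∈ L x
      choose∉       : ∀ {x} → x ∈ xs → choose x ∉ avoid
      choose-inj    : ∀ {x y} → x ∈ xs → y ∈ xs → choose x ≡ choose y → x ≡ y

  record AlmostDistinctChoice (s t : A) (xs : List A) : Set where
    field
      choose     : A → ℕ
      choose∈    : ∀ {x} → x ∈ xs → choose x ∈ L x
      choose-inj : ∀ {x y} → x ∈ xs → y ∈ xs → choose x ≡ choose y → x ≡ y ⊎ (x , y) ≐ (s , t)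

module _ {A : Set} (_≟_ : DecidableEquality A) (L : A → List ℕ) where
  open Update _≟_

  extendChoice : ∀ {x xs avoid c} (old : DistinctChoice L xs avoid) → c ∈ L x → c ∉ avoid ++ map (DistinctChoice.choose old) xs →
                 DistinctChoice L (x ∷ xs) avoid
  extendChoice {x} {xs} {avoid} {c} old c∈L c∉ = record
    { choose = choose ; choose∈ = choose∈ ; choose∉ = choose∉ ; choose-inj = choose-inj }
    where
    module old = DistinctChoice old
    choose : A → ℕ
    choose = old.choose [ x ↦ c ]
    Split : A → Set
    Split y = (y ≡ x × choose y ≡ c) ⊎ (y ∈ xs × choose y ≡ old.choose y)
    split : ∀ {y} → y ∈ x ∷ xs → Split y
    split {y} y∈ = by-cases (y ≟ x) y∈
      where
      by-cases : Dec (y ≡ x) → y ∈ x ∷ xs → Split y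
      by-cases (yes refl) _            = inj₁ (refl , [↦]-≡ old.choose x c)
      by-cases (no y≢x)   (here y≡x)   = contradiction y≡x y≢x
      by-cases (no y≢x)   (there y∈xs) = inj₂ (y∈xs , [↦]-≢ old.choose c y≢x)
    choose∈ : ∀ {y} → y ∈ x ∷ xs → choose y ∈ L y
    choose∈ y∈ with split y∈
    ... | inj₁ (refl , eq)  = subst (_∈ L x) (sym eq) c∈L
    ... | inj₂ (y∈xs , eq)  = subst (_∈ L _) (sym eq) (old.choose∈ y∈xs)
    choose∉ : ∀ {y} → y ∈ x ∷ xs → choose y ∉ avoid
    choose∉ y∈ with split y∈
    ... | inj₁ (refl , eq)  = λ c∈ → c∉ (∈-++⁺ˡ (subst (_∈ avoid) eq c∈))
    ... | inj₂ (y∈xs , eq)  = λ c∈ → old.choose∉ y∈xs (subst (_∈ avoid) eq c∈)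
    c≢old : ∀ {y} → y ∈ xs → c ≢ old.choose y
    c≢old y∈xs eq = c∉ (∈-++⁺ʳ avoid (subst (_∈ _) (sym eq) (∈-map⁺ old.choose y∈xs)))
    choose-inj : ∀ {y z} → y ∈ x ∷ xs → z ∈ x ∷ xs → choose y ≡ choose z → y ≡ z
    choose-inj y∈ z∈ eq with split y∈ | split z∈
    ... | inj₁ (refl , _)   | inj₁ (refl , _)   = refl
    ... | inj₁ (_ , ey)     | inj₂ (z∈xs , ez)  = contradiction (trans (sym ey) (trans eq ez)) (c≢old z∈xs)
    ... | inj₂ (y∈xs , ey)  | inj₁ (_ , ez)     = contradiction (trans (sym ez) (trans (sym eq) ey)) (c≢old y∈xs)
    ... | inj₂ (y∈xs , ey)  | inj₂ (z∈xs , ez)  = old.choose-inj y∈xs z∈xs (trans (sym ey) (trans eq ez))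

  greedyChoice : ∀ xs avoid → Lists≥ L xs (length avoid + length xs) → DistinctChoice L xs avoid
  greedyChoice [] avoid _ = record
    { choose = λ _ → 0 ; choose∈ = λ () ; choose∉ = λ () ; choose-inj = λ () }
  greedyChoice (x ∷ xs) avoid room = extendChoice old (proj₁ (proj₂ fresh)) (proj₂ (proj₂ fresh))
    where
    old : DistinctChoice L xs avoid
    old = greedyChoice xs avoid λ y∈xs →
      let !L , big = room (there y∈xs) in !L , ≤-trans (+-monoʳ-≤ (length avoid) (n≤1+n _)) big
    taken : List ℕ
    taken = avoid ++ map (DistinctChoice.choose old) xs
    taken<L : length taken < length (L x)
    taken<L = begin-strict
      length taken                                                 ≡⟨ length-++ avoid ⟩
      length avoid + length (map (DistinctChoice.choose old) xs)   ≡⟨ cong (length avoid +_) (length-map _ xs) ⟩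
      length avoid + length xs                                     <⟨ +-monoʳ-< (length avoid) (n<1+n _) ⟩
      length avoid + length (x ∷ xs)                               ≤⟨ proj₂ (room (here refl)) ⟩
      length (L x)                                                 ∎
      where open ≤-Reasoning
    fresh : ∃ λ c → c ∈ L x × c ∉ taken
    fresh = ∃-∈-∉ _≟ℕ_ (proj₁ (room (here refl))) taken<L

  almostDistinctChoice : ∀ s t xs → Lists≥ L (s ∷ t ∷ xs) (suc (length xs)) → AlmostDistinctChoice L s t (s ∷ t ∷ xs)
  almostDistinctChoice s t xs room = record { choose = h ; choose∈ = h∈ ; choose-inj = h-inj }
    where
    base : DistinctChoice L (s ∷ xs) []
    base = greedyChoice (s ∷ xs) [] λ where
      (here refl)  → room (here refl)
      (there y∈xs) → room (there (there y∈xs))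
    module base = DistinctChoice base
    fresh : ∃ λ c → c ∈ L t × c ∉ map base.choose xs
    fresh = ∃-∈-∉ _≟ℕ_ (proj₁ (room (there (here refl))))
      (subst (_< length (L t)) (sym (length-map base.choose xs)) (proj₂ (room (there (here refl)))))
    col : ℕ
    col = proj₁ fresh
    h : A → ℕ
    h = base.choose [ t ↦ col ]
    Split : A → Set
    Split y = (y ≡ t × h y ≡ col) ⊎ (y ≢ t × y ∈ s ∷ xs × h y ≡ base.choose y)
    split : ∀ {y} → y ∈ s ∷ t ∷ xs → Split y
    split {y} y∈ = by-cases (y ≟ t) y∈
      where
      by-cases : Dec (y ≡ t) → y ∈ s ∷ t ∷ xs → Split y
      by-cases (yes refl) _                    = inj₁ (refl , [↦]-≡ base.choose t col)
      by-cases (no y≢t)   (here y≡s)           = inj₂ (y≢t , here y≡s , [↦]-≢ base.choose col y≢t)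
      by-cases (no y≢t)   (there (here y≡t))   = contradiction y≡t y≢t
      by-cases (no y≢t)   (there (there y∈xs)) = inj₂ (y≢t , there y∈xs , [↦]-≢ base.choose col y≢t)
    h∈ : ∀ {y} → y ∈ s ∷ t ∷ xs → h y ∈ L y
    h∈ y∈ with split y∈
    ... | inj₁ (refl , eq)    = subst (_∈ L t) (sym eq) (proj₁ (proj₂ fresh))
    ... | inj₂ (_ , y∈′ , eq) = subst (_∈ L _) (sym eq) (base.choose∈ y∈′)
    col≡⇒s : ∀ {y} → y ∈ s ∷ xs → col ≡ base.choose y → y ≡ s
    col≡⇒s (here y≡s)   _  = y≡s
    col≡⇒s (there y∈xs) eq = contradiction (subst (_∈ _) (sym eq) (∈-map⁺ base.choose y∈xs)) (proj₂ (proj₂ fresh))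
    h-inj : ∀ {x y} → x ∈ s ∷ t ∷ xs → y ∈ s ∷ t ∷ xs → h x ≡ h y → x ≡ y ⊎ (x , y) ≐ (s , t)
    h-inj x∈ y∈ eq with split x∈ | split y∈
    ... | inj₁ (refl , _)       | inj₁ (refl , _)       = inj₁ refl
    ... | inj₁ (refl , ex)      | inj₂ (_ , y∈′ , ey)   = inj₂ (inj₂ (refl , col≡⇒s y∈′ (trans (sym ex) (trans eq ey))))
    ... | inj₂ (_ , x∈′ , ex)   | inj₁ (refl , ey)      = inj₂ (inj₁ (col≡⇒s x∈′ (trans (sym ey) (trans (sym eq) ex)) , refl))
    ... | inj₂ (_ , x∈′ , ex)   | inj₂ (_ , y∈′ , ey)   = inj₁ (base.choose-inj x∈′ y∈′ (trans (sym ex) (trans eq ey)))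

module _ {A B : Set} {f : A → B} where

  unique-map⁺ : ∀ {xs} → Unique xs → (∀ {x y} → x ∈ xs → y ∈ xs → f x ≡ f y → x ≡ y) → Unique (map f xs)
  unique-map⁺ []           _   = []
  unique-map⁺ (x∉ ∷ !xs) inj =
    Allₚ.map⁺ (All.tabulate λ y∈ fx≡fy → All.lookup x∉ y∈ (inj (here refl) (there y∈) fx≡fy)) ∷
    unique-map⁺ !xs λ x∈ y∈ → inj (there x∈) (there y∈)

  unique-map⇒injective : ∀ {xs} → Unique (map f xs) → ∀ {x y} → x ∈ xs → y ∈ xs → f x ≡ f y → x ≡ y
  unique-map⇒injective (_ ∷ _)      (here refl) (here refl) _  = refl
  unique-map⇒injective (fx∉ ∷ _)    (here refl) (there y∈)  eq = contradiction eq (All.lookup fx∉ (∈-map⁺ f y∈))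
  unique-map⇒injective (fy∉ ∷ _)    (there x∈)  (here refl) eq = contradiction (sym eq) (All.lookup fy∉ (∈-map⁺ f x∈))
  unique-map⇒injective (_ ∷ !fxs)   (there x∈)  (there y∈)  eq = unique-map⇒injective !fxs x∈ y∈ eq

module _ {n : ℕ} {A : Fin n → Fin n → Bool} where
  open import Data.List.Membership.DecPropositional (_≟ᶠ_ {n}) using () renaming (_∈?_ to _∈ᶠ?_)

  infixr 5 _++ʷ_

  _++ʷ_ : ∀ {u v w} → Walk A u v → Walk A v w → Walk A u w
  nil      ++ʷ q = q
  cons e p ++ʷ q = cons e (p ++ʷ q)

  [_]ʷ : ∀ {u v} → A u v ≡ true → Walk A u v
  [ e ]ʷ = cons e nil

  len-++ʷ : ∀ {u v w} (p : Walk A u v) (q : Walk A v w) → len (p ++ʷ q) ≡ len p + len q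
  len-++ʷ nil        q = refl
  len-++ʷ (cons e p) q = cong suc (len-++ʷ p q)

  ++ʷ-assoc : ∀ {u v w x} (p : Walk A u v) (q : Walk A v w) (r : Walk A w x) →
              (p ++ʷ q) ++ʷ r ≡ p ++ʷ (q ++ʷ r)
  ++ʷ-assoc nil        q r = refl
  ++ʷ-assoc (cons e p) q r = cong (cons e) (++ʷ-assoc p q r)

  start∈verts : ∀ {u v} (p : Walk A u v) → u ∈ verts p
  start∈verts nil        = here refl
  start∈verts (cons _ _) = here refl

  end∈verts : ∀ {u v} (p : Walk A u v) → v ∈ verts p
  end∈verts nil        = here refl
  end∈verts (cons _ p) = there (end∈verts p)

  ∈-verts-++ʷ⁺ˡ : ∀ {u v w} (p : Walk A u v) (q : Walk A v w) → verts p ⊆ verts (p ++ʷ q)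
  ∈-verts-++ʷ⁺ˡ nil        q (here refl) = start∈verts q
  ∈-verts-++ʷ⁺ˡ (cons e p) q (here refl) = here refl
  ∈-verts-++ʷ⁺ˡ (cons e p) q (there x∈) = there (∈-verts-++ʷ⁺ˡ p q x∈)

  ∈-verts-++ʷ⁺ʳ : ∀ {u v w} (p : Walk A u v) (q : Walk A v w) → verts q ⊆ verts (p ++ʷ q)
  ∈-verts-++ʷ⁺ʳ nil        q x∈ = x∈
  ∈-verts-++ʷ⁺ʳ (cons e p) q x∈ = there (∈-verts-++ʷ⁺ʳ p q x∈)

  ∈-verts-++ʷ⁻ : ∀ {u v w} (p : Walk A u v) (q : Walk A v w) {x} →
                 x ∈ verts (p ++ʷ q) → x ∈ verts p ⊎ x ∈ verts q
  ∈-verts-++ʷ⁻ nil        q x∈          = inj₂ x∈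
  ∈-verts-++ʷ⁻ (cons e p) q (here refl) = inj₁ (here refl)
  ∈-verts-++ʷ⁻ (cons e p) q (there x∈) with ∈-verts-++ʷ⁻ p q x∈
  ... | inj₁ x∈p = inj₁ (there x∈p)
  ... | inj₂ x∈q = inj₂ x∈q

  isPath-++ʷˡ : ∀ {u v w} (p : Walk A u v) (q : Walk A v w) → IsPath (p ++ʷ q) → IsPath p
  isPath-++ʷˡ nil        q _           = [] ∷ []
  isPath-++ʷˡ (cons e p) q (u∉ ∷ !pq) =
    All.tabulate (λ x∈p → All.lookup u∉ (∈-verts-++ʷ⁺ˡ p q x∈p)) ∷ isPath-++ʷˡ p q !pq

  isPath-++ʷʳ : ∀ {u v w} (p : Walk A u v) (q : Walk A v w) → IsPath (p ++ʷ q) → IsPath q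
  isPath-++ʷʳ nil        q !q        = !q
  isPath-++ʷʳ (cons e p) q (_ ∷ !pq) = isPath-++ʷʳ p q !pq

  verts-∷ʳ : ∀ {u v w} (p : Walk A u v) (e : A v w ≡ true) → verts (p ++ʷ [ e ]ʷ) ≡ verts p ++ [ w ]
  verts-∷ʳ nil        e = refl
  verts-∷ʳ (cons _ p) e = cong (_ ∷_) (verts-∷ʳ p e)

  isPath-∷ʳ : ∀ {u v w} (p : Walk A u v) (e : A v w ≡ true) → IsPath p → w ∉ verts p → IsPath (p ++ʷ [ e ]ʷ)
  isPath-∷ʳ p e !p w∉p = subst Unique (sym (verts-∷ʳ p e))
    (Uniqueₚ.++⁺ !p ([] ∷ []) λ where (x∈p , here refl) → w∉p x∈p)

  module _ (A-sym : ∀ {a b} → A a b ≡ true → A b a ≡ true) where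

    reverseʷ : ∀ {u v} → Walk A u v → Walk A v u
    reverseʷ nil        = nil
    reverseʷ (cons e p) = reverseʷ p ++ʷ [ A-sym e ]ʷ

    len-reverseʷ : ∀ {u v} (p : Walk A u v) → len (reverseʷ p) ≡ len p
    len-reverseʷ nil        = refl
    len-reverseʷ (cons e p) = begin
      len (reverseʷ p ++ʷ [ A-sym e ]ʷ) ≡⟨ len-++ʷ (reverseʷ p) _ ⟩
      len (reverseʷ p) + 1              ≡⟨ +-comm (len (reverseʷ p)) 1 ⟩
      suc (len (reverseʷ p))            ≡⟨ cong suc (len-reverseʷ p) ⟩
      suc (len p)                       ∎
      where open ≡-Reasoning

    ∈-verts-reverseʷ : ∀ {u v} (p : Walk A u v) → verts (reverseʷ p) ⊆ verts p
    ∈-verts-reverseʷ nil        x∈ = x∈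
    ∈-verts-reverseʷ (cons e p) x∈ with ∈-verts-++ʷ⁻ (reverseʷ p) _ x∈
    ... | inj₁ x∈rp               = there (∈-verts-reverseʷ p x∈rp)
    ... | inj₂ (here refl)        = there (start∈verts p)
    ... | inj₂ (there (here refl)) = here refl

    isPath-reverseʷ : ∀ {u v} (p : Walk A u v) → IsPath p → IsPath (reverseʷ p)
    isPath-reverseʷ nil        !p         = !p
    isPath-reverseʷ (cons e p) (u∉ ∷ !p) =
      isPath-∷ʳ (reverseʷ p) _ (isPath-reverseʷ p !p) λ u∈ → All.lookup u∉ (∈-verts-reverseʷ p u∈) refl

  record PathWithin (u v : Fin n) (ℓ : ℕ) (vs : List (Fin n)) : Set where
    field
      path   : Walk A u v
      isPath : IsPath path
      len≤   : len path ≤ ℓ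
      verts⊆ : verts path ⊆ vs

  private
    suffixFrom : ∀ {u w v} (q : Walk A w v) → IsPath q → u ∈ verts q → PathWithin u v (len q) (verts q)
    suffixFrom nil          !q        (here refl) = record { path = nil ; isPath = !q ; len≤ = ≤-refl ; verts⊆ = λ x∈ → x∈ }
    suffixFrom q@(cons _ _) !q        (here refl) = record { path = q ; isPath = !q ; len≤ = ≤-refl ; verts⊆ = λ x∈ → x∈ }
    suffixFrom (cons e q) (_ ∷ !q) (there u∈)  = record
      { path = path ; isPath = isPath ; len≤ = m≤n⇒m≤1+n len≤ ; verts⊆ = there ∘ verts⊆ }
      where open PathWithin (suffixFrom q !q u∈)

    shortcut-cons : ∀ {u w v} (e : A u w ≡ true) (p : Walk A w v) → PathWithin w v (len p) (verts p) →
                    PathWithin u v (len (cons e p)) (verts (cons e p))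
    shortcut-cons {u} e p q with u ∈ᶠ? verts (PathWithin.path q)
    ... | yes u∈q = record
      { path = path ; isPath = isPath ; len≤ = m≤n⇒m≤1+n (≤-trans len≤ (PathWithin.len≤ q))
      ; verts⊆ = there ∘ PathWithin.verts⊆ q ∘ verts⊆ }
      where open PathWithin (suffixFrom (PathWithin.path q) (PathWithin.isPath q) u∈q)
    ... | no u∉q = record
      { path = cons e path ; isPath = Allₚ.¬Any⇒All¬ _ u∉q ∷ isPath
      ; len≤ = s≤s len≤ ; verts⊆ = λ where (here refl) → here refl ; (there x∈) → there (verts⊆ x∈) }
      where open PathWithin q

  shortcut : ∀ {u v} (p : Walk A u v) → PathWithin u v (len p) (verts p)
  shortcut nil        = record { path = nil ; isPath = [] ∷ [] ; len≤ = ≤-refl ; verts⊆ = λ x∈ → x∈ }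
  shortcut (cons e p) = shortcut-cons e p (shortcut p)

  walkOfLength? : ∀ ℓ u v → Dec (∃ λ (p : Walk A u v) → len p ≡ ℓ)
  walkOfLength? zero u v with u ≟ᶠ v
  ... | yes refl = yes (nil , refl)
  ... | no  u≢v  = no λ where (nil , _) → u≢v refl
  walkOfLength? (suc ℓ) u v with Finₚ.any? (λ w → (A u w ≟ᵇ true) ×-dec walkOfLength? ℓ w v)
  ... | yes (w , e , p , refl) = yes (cons e p , refl)
  ... | no  ∄walk              = no λ where (cons e p , refl) → ∄walk (_ , e , p , refl)

  Shortest : ∀ {u v} → Walk A u v → Set
  Shortest {u} {v} p = IsPath p × (∀ (q : Walk A u v) → len p ≤ len q)

  shortest : ∀ {u v} → Walk A u v → Σ (Walk A u v) Shortest
  shortest {u} {v} p₀ = path , isPath , λ r → ≤-trans len≤ (proj₂ shortestWalk r)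
    where
    minimal : (p : Walk A u v) → Acc _<_ (len p) → Σ (Walk A u v) λ p → ∀ q → len p ≤ len q
    minimal p (acc shorter) with anyUpTo? (λ ℓ → walkOfLength? ℓ u v) (len p)
    ... | yes (_ , ℓ<p , q , refl) = minimal q (shorter ℓ<p)
    ... | no  ∄shorter             = p , λ q → ≮⇒≥ λ q<p → ∄shorter (len q , q<p , q , refl)
    shortestWalk : Σ (Walk A u v) λ q → ∀ r → len q ≤ len r
    shortestWalk = minimal p₀ (<-wellFounded (len p₀))
    open PathWithin (shortcut (proj₁ shortestWalk))

  shortest⇒geodesic : ∀ {u v} {p : Walk A u v} → Shortest p → Geodesic p
  shortest⇒geodesic (!p , p-min) = !p , λ q _ → p-min q

  shortest-segment : ∀ {u v x y x′ y′} {Q : Walk A u v} → Shortest Q →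
                     (Q₁ : Walk A u x) (e : A x y ≡ true) (R : Walk A y x′) (e′ : A x′ y′ ≡ true) (T : Walk A y′ v) →
                     Q ≡ Q₁ ++ʷ cons e (R ++ʷ cons e′ T) → (W : Walk A x y′) → len R + 2 ≤ len W
  shortest-segment (_ , Q-min) Q₁ e R e′ T refl W =
    +-cancelʳ-≤ (len T) _ _ (+-cancelˡ-≤ (len Q₁) _ _ (begin
      len Q₁ + (len R + 2 + len T)                   ≡⟨ cong (len Q₁ +_) (+-assoc (len R) 2 (len T)) ⟩
      len Q₁ + (len R + suc (suc (len T)))           ≡⟨ cong (len Q₁ +_) (trans (+-suc (len R) _) (cong suc (sym (len-++ʷ R (cons e′ T))))) ⟩
      len Q₁ + len (cons e (R ++ʷ cons e′ T))        ≡⟨ len-++ʷ Q₁ _ ⟨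
      len (Q₁ ++ʷ cons e (R ++ʷ cons e′ T))          ≤⟨ Q-min (Q₁ ++ʷ W ++ʷ T) ⟩
      len (Q₁ ++ʷ W ++ʷ T)                           ≡⟨ trans (len-++ʷ Q₁ _) (cong (len Q₁ +_) (len-++ʷ W T)) ⟩
      len Q₁ + (len W + len T)                       ∎))
    where open ≤-Reasoning

  edges : ∀ {u v} → Walk A u v → List (Fin n × Fin n)
  edges nil                      = []
  edges (cons {u = u} {w = w} _ p) = (u , w) ∷ edges p

  edges-++ʷ : ∀ {u v w} (p : Walk A u v) (q : Walk A v w) → edges (p ++ʷ q) ≡ edges p ++ edges q
  edges-++ʷ nil        q = refl
  edges-++ʷ (cons e p) q = cong (_ ∷_) (edges-++ʷ p q)

  edgeColours≡ : ∀ {u v} c (p : Walk A u v) → edgeColours c p ≡ map (uncurry c) (edges p)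
  edgeColours≡ c nil        = refl
  edgeColours≡ c (cons e p) = cong (_ ∷_) (edgeColours≡ c p)

  ∈-edges⇒adj : ∀ {u v a b} (p : Walk A u v) → (a , b) ∈ edges p → A a b ≡ true
  ∈-edges⇒adj (cons e p) (here refl) = e
  ∈-edges⇒adj (cons e p) (there ab∈) = ∈-edges⇒adj p ab∈

  ∈-edges⇒∈-verts : ∀ {u v a b} (p : Walk A u v) → (a , b) ∈ edges p → a ∈ verts p × b ∈ verts p
  ∈-edges⇒∈-verts (cons e p) (here refl) = here refl , there (start∈verts p)
  ∈-edges⇒∈-verts (cons e p) (there ab∈) = let a∈ , b∈ = ∈-edges⇒∈-verts p ab∈ in there a∈ , there b∈

  splitAtEdge : ∀ {u v a b} (p : Walk A u v) → (a , b) ∈ edges p →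
                ∃ λ (p₁ : Walk A u a) → ∃ λ (e : A a b ≡ true) → ∃ λ (p₂ : Walk A b v) → p ≡ p₁ ++ʷ cons e p₂
  splitAtEdge (cons e p) (here refl) = nil , e , p , refl
  splitAtEdge (cons e p) (there ab∈) with splitAtEdge p ab∈
  ... | p₁ , e′ , p₂ , refl = cons e p₁ , e′ , p₂ , refl

  splitAtLength : ∀ {u v} (p : Walk A u v) k → k ≤ len p →
                  ∃ λ w → ∃ λ (p₁ : Walk A u w) → ∃ λ (p₂ : Walk A w v) → len p₁ ≡ k × p ≡ p₁ ++ʷ p₂
  splitAtLength p          zero    _         = _ , nil , p , refl , refl
  splitAtLength (cons e p) (suc k) (s≤s k≤p) with splitAtLength p k k≤p
  ... | w , p₁ , p₂ , refl , refl = w , cons e p₁ , p₂ , refl , refl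

module _ {m n : ℕ} {A : Fin m → Fin m → Bool} {B : Fin n → Fin n → Bool} (f : Fin m → Fin n)
         (f-adj : ∀ {a b} → A a b ≡ true → B (f a) (f b) ≡ true) where

  mapʷ : ∀ {u v} → Walk A u v → Walk B (f u) (f v)
  mapʷ nil        = nil
  mapʷ (cons e p) = cons (f-adj e) (mapʷ p)

  len-mapʷ : ∀ {u v} (p : Walk A u v) → len (mapʷ p) ≡ len p
  len-mapʷ nil        = refl
  len-mapʷ (cons e p) = cong suc (len-mapʷ p)

  verts-mapʷ : ∀ {u v} (p : Walk A u v) → verts (mapʷ p) ≡ map f (verts p)
  verts-mapʷ nil        = refl
  verts-mapʷ (cons e p) = cong (_ ∷_) (verts-mapʷ p)

-- Comparing the four parameters

someEdge : ∀ {n} (G : Graph n) → 2 ≤ n → Connected G → ∃ λ a → ∃ λ b → Edge G a b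
someEdge {suc (suc _)} G (s≤s (s≤s _)) connected with connected Fin.zero (Fin.suc Fin.zero)
... | cons ab _ = _ , _ , ab

module _ {n : ℕ} (G : Graph n) where

  Edge-sym : ∀ {a b} → Edge G a b → Edge G b a
  Edge-sym {a} {b} e = trans (Graph.sym G b a) e

  Edge⇒≢ : ∀ {a b} → Edge G a b → a ≢ b
  Edge⇒≢ {a} e refl = contradiction (trans (sym (irrefl G a)) e) λ ()

  single-geodesic : ∀ {u v} (e : Edge G u v) → Geodesic {A = adj G} [ e ]ʷ
  single-geodesic e = (Edge⇒≢ e ∷ []) ∷ [] ∷ [] , λ where
    nil        _ → contradiction refl (Edge⇒≢ e)
    (cons _ _) _ → s≤s z≤n

  nil-geodesic : ∀ {u} → Geodesic {A = adj G} {u} nil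
  nil-geodesic = [] ∷ [] , λ _ _ → z≤n

  rainbow⇒len≤ : ∀ {k c u v} → UsesColours G k c → (p : Walk (adj G) u v) → Rainbow c p → len p ≤ k
  rainbow⇒len≤ {k} {c} (_ , c<k) p rainbow = begin
    len p                      ≡⟨ len-colours p ⟨
    length (edgeColours c p)   ≤⟨ unique⊆⇒length≤ rainbow (∈-upTo⁺ ∘ colours<k p) ⟩
    length (upTo k)            ≡⟨ length-upTo k ⟩
    k                          ∎
    where
    open ≤-Reasoning
    len-colours : ∀ {u v} (p : Walk (adj G) u v) → length (edgeColours c p) ≡ len p
    len-colours nil        = refl
    len-colours (cons e p) = cong suc (len-colours p)
    colours<k : ∀ {u v} (p : Walk (adj G) u v) {x} → x ∈ edgeColours c p → x < k
    colours<k (cons e p) (here refl) = c<k _ _ e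
    colours<k (cons e p) (there x∈) = colours<k p x∈

  SRC⇒RC : ∀ {k} → SRC G k → RC G k
  SRC⇒RC (c , uses , src) = c , uses , λ u v → let p , (!p , _) , rainbow = src u v in p , !p , rainbow

  SRCL⇒RCL : ∀ {k} → SRCL G k → RCL G k
  SRCL⇒RCL srcl L isL = let c , isLc , src = srcl L isL in
    c , isLc , λ u v → let p , (!p , _) , rainbow = src u v in p , !p , rainbow

  -- a k-colouring is an L-colouring for the constant lists upTo k
  private
    upToLists : ∀ k → ListAssignment G k (λ _ _ → upTo k)
    upToLists k = (λ _ _ _ → refl) , λ _ _ _ → Uniqueₚ.upTo⁺ k , ≤-reflexive (sym (length-upTo k))

    upToColouring⇒uses : ∀ {k c} → LColouring G (λ _ _ → upTo k) c → UsesColours G k c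
    upToColouring⇒uses (c-sym , c∈) = c-sym , λ i j e → ∈-upTo⁻ (c∈ i j e)

  RCL⇒RC : ∀ {k} → RCL G k → RC G k
  RCL⇒RC {k} rcl = let c , isLc , rc = rcl _ (upToLists k) in c , upToColouring⇒uses isLc , rc

  SRCL⇒SRC : ∀ {k} → SRCL G k → SRC G k
  SRCL⇒SRC {k} srcl = let c , isLc , src = srcl _ (upToLists k) in c , upToColouring⇒uses isLc , src

  diam≤rc : ∀ {D k} → IsDiam G D → RC G k → D ≤ k
  diam≤rc (_ , u , v , _ , dist-min) (c , uses , rc) =
    let p , !p , rainbow = rc u v in ≤-trans (dist-min p !p) (rainbow⇒len≤ uses p rainbow)

  Diam1⇒Complete : IsDiam G 1 → Complete G
  Diam1⇒Complete (dist≤1 , _) i j i≢j with dist≤1 i j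
  ... | _ , ((nil , _) , _) , _                    = contradiction refl i≢j
  ... | _ , ((cons e nil , _) , _) , _             = e
  ... | _ , ((cons _ (cons _ _) , _ , refl) , _) , s≤s ()

  RC1⇒Complete : RC G 1 → Complete G
  RC1⇒Complete (c , uses , rc) i j i≢j with rc i j
  ... | nil , _                = contradiction refl i≢j
  ... | cons e nil , _         = e
  ... | p@(cons _ (cons _ _)) , _ , rainbow with rainbow⇒len≤ uses p rainbow
  ... | s≤s ()

  Complete⇒SRCL1 : Complete G → SRCL G 1
  Complete⇒SRCL1 complete L (L-sym , L-big) = c , (c-sym , c∈L) , src
    where
    c : Fin n → Fin n → ℕ
    c a b = head₀ (L a b)
    c-sym : SymOnEdges G c
    c-sym a b e = cong head₀ (L-sym a b e)
    c∈L : ∀ a b → Edge G a b → c a b ∈ L a b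
    c∈L a b e = head₀∈ (proj₂ (L-big a b e))
    src : StronglyRainbowConnected G c
    src u v with u ≟ᶠ v
    ... | yes refl = nil , nil-geodesic , []
    ... | no  u≢v  = [ complete u v u≢v ]ʷ , single-geodesic (complete u v u≢v) , [] ∷ []

  -- with two colours every rainbow path between non-adjacent vertices has length 2, hence is geodesic
  RC2⇒SRC2 : RC G 2 → SRC G 2
  RC2⇒SRC2 (c , uses , rc) = c , uses , src
    where
    src : StronglyRainbowConnected G c
    src u v with u ≟ᶠ v | adj G u v ≟ᵇ true
    ... | yes refl | _      = nil , nil-geodesic , []
    ... | no _     | yes e  = [ e ]ʷ , single-geodesic e , [] ∷ []
    ... | no u≢v   | no ¬e  = let p , !p , rainbow = rc u v in
      p , (!p , λ q _ → ≤-trans (rainbow⇒len≤ uses p rainbow) (2≤len q)) , rainbow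
      where
      2≤len : (q : Walk (adj G) u v) → 2 ≤ len q
      2≤len nil                 = contradiction refl u≢v
      2≤len (cons e nil)        = contradiction e ¬e
      2≤len (cons _ (cons _ _)) = s≤s (s≤s z≤n)

  module _ (2≤n : 2 ≤ n) (connected : Connected G) where

    ¬RC0 : ¬ RC G 0
    ¬RC0 (c , (_ , c<0) , _) with someEdge G 2≤n connected
    ... | a , b , e with c<0 a b e
    ... | ()

    Complete⇒Diam1 : Complete G → IsDiam G 1
    Complete⇒Diam1 complete with someEdge G 2≤n connected
    ... | a , b , ab = dist≤1 , a , b , ([ ab ]ʷ , proj₁ (single-geodesic ab) , refl) , proj₂ (single-geodesic ab)
      where
      dist≤1 : ∀ u v → ∃ λ d → IsDist G u v d × d ≤ 1
      dist≤1 u v with u ≟ᶠ v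
      ... | yes refl = 0 , ((nil , [] ∷ [] , refl) , λ _ _ → z≤n) , z≤n
      ... | no u≢v   = let e = complete u v u≢v in
        1 , (([ e ]ʷ , proj₁ (single-geodesic e) , refl) , proj₂ (single-geodesic e)) , ≤-refl

module _ {n : ℕ} where

  _≟ᵏ_ : DecidableEquality (Fin n × Fin n)
  _≟ᵏ_ = ≡-dec _≟ᶠ_ _≟ᶠ_

  -- an unordered pair {a, b} is represented by its sorted pair
  key : Fin n → Fin n → Fin n × Fin n
  key a b with toℕ a <? toℕ b
  ... | yes _ = a , b
  ... | no  _ = b , a

  key≐ : ∀ a b → key a b ≐ (a , b)
  key≐ a b with toℕ a <? toℕ b
  ... | yes _ = inj₁ (refl , refl)
  ... | no  _ = inj₂ (refl , refl)

  key-comm : ∀ a b → key a b ≡ key b a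
  key-comm a b with toℕ a <? toℕ b | toℕ b <? toℕ a
  ... | yes a<b | yes b<a = contradiction a<b (<⇒≯ b<a)
  ... | yes _   | no  _   = refl
  ... | no  _   | yes _   = refl
  ... | no  a≮b | no  b≮a with Finₚ.toℕ-injective (≤-antisym (≮⇒≥ b≮a) (≮⇒≥ a≮b))
  ...   | refl = refl

  key≡⇒≐ : ∀ {a b x y} → key a b ≡ key x y → (a , b) ≐ (x , y)
  key≡⇒≐ {a} {b} {x} {y} eq = ≐-trans (≐-sym (key≐ a b)) (subst (_≐ (x , y)) (sym eq) (key≐ x y))

  keys : ∀ {A : Fin n → Fin n → Bool} {u v} → Walk A u v → List (Fin n × Fin n)
  keys p = map (uncurry key) (edges p)

  keys-++ʷ : ∀ {A : Fin n → Fin n → Bool} {u v w} (p : Walk A u v) (q : Walk A v w) → keys (p ++ʷ q) ≡ keys p ++ keys q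
  keys-++ʷ p q = trans (cong (map (uncurry key)) (edges-++ʷ p q)) (map-++ (uncurry key) (edges p) (edges q))

  key∉keys : ∀ {A : Fin n → Fin n → Bool} {u v x} (p : Walk A u v) → x ∉ verts p → ∀ y → key x y ∉ keys p
  key∉keys p x∉p y k∈ with ∈-map⁻ (uncurry key) k∈
  ... | (a , b) , ab∈ , eq with key≡⇒≐ eq | ∈-edges⇒∈-verts p ab∈
  ... | inj₁ (refl , _) | a∈ , _ = x∉p a∈
  ... | inj₂ (refl , _) | _ , b∈ = x∉p b∈

  keys-unique : ∀ {A : Fin n → Fin n → Bool} {u v} (p : Walk A u v) → IsPath p → Unique (keys p)
  keys-unique nil                        _          = []
  keys-unique (cons {u = u} {w = w} _ p) (u∉ ∷ !p) =
    Allₚ.¬Any⇒All¬ (keys p) (key∉keys p (Allₚ.All¬⇒¬Any u∉) w) ∷ keys-unique p !p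

  keyed : (Fin n × Fin n → ℕ) → Fin n → Fin n → ℕ
  keyed h a b = h (key a b)

  edgeColours-keyed : ∀ {A : Fin n → Fin n → Bool} {u v} h (p : Walk A u v) → edgeColours (keyed h) p ≡ map h (keys p)
  edgeColours-keyed h nil        = refl
  edgeColours-keyed h (cons e p) = cong (_ ∷_) (edgeColours-keyed h p)

  keyed-rainbow : ∀ {A : Fin n → Fin n → Bool} {u v} h (p : Walk A u v) → IsPath p →
                  (∀ {k k′} → k ∈ keys p → k′ ∈ keys p → h k ≡ h k′ → k ≡ k′) → Rainbow (keyed h) p
  keyed-rainbow h p !p h-inj = subst Unique (sym (edgeColours-keyed h p)) (unique-map⁺ (keys-unique p !p) h-inj)

module _ {n : ℕ} (G : Graph n) where

  private
    row : Fin n → List (Fin n × Fin n)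
    row i = map (i ,_) (filter (λ j → toℕ i <? toℕ j) (filter (λ j → adj G i j ≟ᵇ true) (allFin n)))

    ∈-row⁻ : ∀ {i k} → k ∈ row i → ∃ λ j → k ≡ (i , j) × Edge G i j × toℕ i < toℕ j
    ∈-row⁻ {i} k∈ with ∈-map⁻ (i ,_) k∈
    ... | j , j∈ , refl with ∈-filter⁻ (λ j → toℕ i <? toℕ j) {xs = filter (λ j → adj G i j ≟ᵇ true) (allFin n)} j∈
    ... | j∈′ , i<j = j , refl , proj₂ (∈-filter⁻ (λ j → adj G i j ≟ᵇ true) {xs = allFin n} j∈′) , i<j

  ∈-edgeList⁻ : ∀ {i j} → (i , j) ∈ edgeList G → Edge G i j × toℕ i < toℕ j
  ∈-edgeList⁻ ij∈ with find (∈-concatMap⁻ row {xs = allFin n} ij∈)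
  ... | _ , _ , ij∈row with ∈-row⁻ ij∈row
  ... | _ , refl , ij , i<j = ij , i<j

  ∈-edgeList⁺ : ∀ {i j} → Edge G i j → toℕ i < toℕ j → (i , j) ∈ edgeList G
  ∈-edgeList⁺ {i} {j} ij i<j = ∈-concatMap⁺ row (lose (∈-allFin i)
    (∈-map⁺ (i ,_) (∈-filter⁺ _ (∈-filter⁺ _ (∈-allFin j) ij) i<j)))

  edgeList-unique : Unique (edgeList G)
  edgeList-unique = Uniqueₚ.concat⁺
    (Allₚ.map⁺ (All.tabulate λ {i} _ → Uniqueₚ.map⁺ (λ where refl → refl) (Uniqueₚ.filter⁺ _ (Uniqueₚ.filter⁺ _ (Uniqueₚ.allFin⁺ n)))))
    (AllPairsₚ.map⁺ (AllPairs.map (λ i≢i′ {_} (k∈ , k∈′) → i≢i′ (same-row k∈ k∈′)) (Uniqueₚ.allFin⁺ n)))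
    where
    same-row : ∀ {i i′ k} → k ∈ row i → k ∈ row i′ → i ≡ i′
    same-row k∈ k∈′ with ∈-row⁻ k∈ | ∈-row⁻ k∈′
    ... | _ , refl , _ | _ , refl , _ = refl

  key∈edgeList : ∀ {a b} → Edge G a b → key a b ∈ edgeList G
  key∈edgeList {a} {b} ab with toℕ a <? toℕ b
  ... | yes a<b = ∈-edgeList⁺ ab a<b
  ... | no  a≮b = ∈-edgeList⁺ (Edge-sym G ab) (≤∧≢⇒< (≮⇒≥ a≮b) λ b≡a → Edge⇒≢ G ab (Finₚ.toℕ-injective (sym b≡a)))

  keys⊆edgeList : ∀ {u v} (p : Walk (adj G) u v) → keys p ⊆ edgeList G
  keys⊆edgeList p k∈ with ∈-map⁻ (uncurry key) k∈
  ... | _ , ab∈ , refl = key∈edgeList (∈-edges⇒adj p ab∈)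

  keyed-LColouring : ∀ {L} h → SymOnEdges G L → (∀ {k} → k ∈ edgeList G → h k ∈ uncurry L k) → LColouring G L (keyed h)
  keyed-LColouring {L} h L-sym h∈ = (λ a b _ → cong h (key-comm a b)) , keyed∈
    where
    keyed∈ : ∀ a b → Edge G a b → keyed h a b ∈ L a b
    keyed∈ a b ab with key≐ a b
    ... | inj₁ (k₁≡a , k₂≡b) = subst₂ (λ x y → keyed h a b ∈ L x y) k₁≡a k₂≡b (h∈ (key∈edgeList ab))
    ... | inj₂ (k₁≡b , k₂≡a) = subst (keyed h a b ∈_) (L-sym b a (Edge-sym G ab))
                                 (subst₂ (λ x y → keyed h a b ∈ L x y) k₁≡b k₂≡a (h∈ (key∈edgeList ab)))

  SRCL-e : Connected G → SRCL G (e G)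
  SRCL-e connected L (L-sym , L-big) = keyed choose , keyed-LColouring choose L-sym choose∈ , src
    where
    room : Lists≥ (uncurry L) (edgeList G) (e G)
    room {i , j} ij∈ = L-big i j (proj₁ (∈-edgeList⁻ ij∈))
    open DistinctChoice (greedyChoice _≟ᵏ_ (uncurry L) (edgeList G) [] room)
    src : StronglyRainbowConnected G (keyed choose)
    src u v = let q , q-shortest = shortest (connected u v) in
      q , shortest⇒geodesic q-shortest ,
      keyed-rainbow choose q (proj₁ q-shortest) λ k∈ k′∈ → choose-inj (keys⊆edgeList q k∈) (keys⊆edgeList q k′∈)

-- Growing a rainbow spanning tree

module _ {n : ℕ} (G : Graph n) {L : Fin n → Fin n → List ℕ} (isL : ListAssignment G (n ∸ 1) L) where
  open Update (_≟ᵏ_ {n})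
  open import Data.List.Membership.DecPropositional (_≟ᶠ_ {n}) using () renaming (_∈?_ to _∈ᶠ?_)

  private
    keyLists : ∀ {k} → k ∈ edgeList G → Unique (uncurry L k) × n ∸ 1 ≤ length (uncurry L k)
    keyLists {i , j} ij∈ = proj₂ isL i j (proj₁ (∈-edgeList⁻ G ij∈))

  record InsidePath (S : List (Fin n)) (h : Fin n × Fin n → ℕ) (used : List ℕ) (a b : Fin n) : Set where
    field
      path     : Walk (adj G) a b
      isPath   : IsPath path
      rainbow  : Unique (map h (keys path))
      inside   : verts path ⊆ S
      colours⊆ : map h (keys path) ⊆ used

  record Grown (S : List (Fin n)) : Set where
    field
      S-unique : Unique S
      h        : Fin n × Fin n → ℕ
      h∈L      : ∀ {k} → k ∈ edgeList G → h k ∈ uncurry L k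
      used     : List ℕ
      used<S   : length used < length S
      paths    : ∀ {a b} → a ∈ S → b ∈ S → InsidePath S h used a b

  grown-singleton : 1 ≤ n ∸ 1 → ∀ r → Grown [ r ]
  grown-singleton 1≤n-1 r = record
    { S-unique = [] ∷ []
    ; h        = head₀ ∘ uncurry L
    ; h∈L      = λ k∈ → head₀∈ (≤-trans 1≤n-1 (proj₂ (keyLists k∈)))
    ; used     = []
    ; used<S   = s≤s z≤n
    ; paths    = λ where (here refl) (here refl) → trivial
    }
    where
    trivial : InsidePath [ r ] (head₀ ∘ uncurry L) [] r r
    trivial = record
      { path = nil ; isPath = [] ∷ [] ; rainbow = [] ; inside = λ { (here refl) → here refl } ; colours⊆ = λ () }

  -- the new tree edge gets a colour not used inside S, so every path through it stays rainbow
  module GrowStep {S x p} (grown : Grown S) (x∉S : x ∉ S) (p∈S : p ∈ S) (xp : Edge G x p) where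
    open Grown grown
    x∷S-unique : Unique (x ∷ S)
    x∷S-unique = Allₚ.¬Any⇒All¬ S x∉S ∷ S-unique
    used<L : length used < length (uncurry L (key x p))
    used<L = begin-strict
      length used                     <⟨ used<S ⟩
      length S                        ≤⟨ <⇒≤pred (unique-Fin⇒length≤ x∷S-unique) ⟩
      pred n                          ≡⟨ pred[m∸n]≡m∸[1+n] n 0 ⟩
      n ∸ 1                           ≤⟨ proj₂ (keyLists (key∈edgeList G xp)) ⟩
      length (uncurry L (key x p))    ∎
      where open ≤-Reasoning
    fresh : ∃ λ c → c ∈ uncurry L (key x p) × c ∉ used
    fresh = ∃-∈-∉ _≟ℕ_ (proj₁ (keyLists (key∈edgeList G xp))) used<L
    col : ℕ
    col = proj₁ fresh
    h′ : Fin n × Fin n → ℕ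
    h′ = h [ key x p ↦ col ]
    h′-new : h′ (key x p) ≡ col
    h′-new = [↦]-≡ h (key x p) col
    h′∈L : ∀ {k} → k ∈ edgeList G → h′ k ∈ uncurry L k
    h′∈L {k} k∈ = by-cases (k ≟ᵏ key x p)
      where
      by-cases : Dec (k ≡ key x p) → h′ k ∈ uncurry L k
      by-cases (yes refl) = subst (_∈ _) (sym h′-new) (proj₁ (proj₂ fresh))
      by-cases (no  k≢)   = subst (_∈ _) (sym ([↦]-≢ h col k≢)) (h∈L k∈)
    h′-old : ∀ {a b} (q : Walk (adj G) a b) → verts q ⊆ S → map h′ (keys q) ≡ map h (keys q)
    h′-old q q⊆S = map-cong-local (All.tabulate λ k∈ →
      [↦]-≢ h col λ where refl → key∉keys q (x∉S ∘ q⊆S) p k∈)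
    col∉ : ∀ {a b} (q : InsidePath S h used a b) → All (col ≢_) (map h (keys (InsidePath.path q)))
    col∉ q = All.tabulate λ c∈ col≡ → proj₂ (proj₂ fresh) (InsidePath.colours⊆ q (subst (_∈ _) (sym col≡) c∈))

    old : ∀ {a b} → a ∈ S → b ∈ S → InsidePath (x ∷ S) h′ (col ∷ used) a b
    old a∈ b∈ = record
      { path = path ; isPath = isPath ; rainbow = subst Unique (sym (h′-old path inside)) rainbow
      ; inside = there ∘ inside ; colours⊆ = λ {c} → there ∘ colours⊆ ∘ subst (c ∈_) (h′-old path inside) }
      where open InsidePath (paths a∈ b∈)

    from-x : ∀ {b} → b ∈ S → InsidePath (x ∷ S) h′ (col ∷ used) x b
    from-x {b} b∈ = record
      { path = cons xp path
      ; isPath = Allₚ.¬Any⇒All¬ _ (x∉S ∘ inside) ∷ isPath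
      ; rainbow = subst Unique (sym colours≡) (col∉ q ∷ rainbow)
      ; inside = λ where (here refl) → here refl
                         (there y∈) → there (inside y∈)
      ; colours⊆ = λ {c} c∈ → case-∷ (subst (c ∈_) colours≡ c∈) }
      where
      q : InsidePath S h used p b
      q = paths p∈S b∈
      open InsidePath q
      colours≡ : map h′ (keys (cons xp path)) ≡ col ∷ map h (keys path)
      colours≡ = cong₂ _∷_ h′-new (h′-old path inside)
      case-∷ : ∀ {c} → c ∈ col ∷ map h (keys path) → c ∈ col ∷ used
      case-∷ (here refl) = here refl
      case-∷ (there c∈) = there (colours⊆ c∈)

    to-x : ∀ {a} → a ∈ S → InsidePath (x ∷ S) h′ (col ∷ used) a x
    to-x {a} a∈ = record
      { path = path ++ʷ [ px ]ʷ
      ; isPath = isPath-∷ʳ path px isPath (x∉S ∘ inside)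
      ; rainbow = subst Unique (sym colours≡)
          (Uniqueₚ.++⁺ rainbow ([] ∷ []) λ where (c∈ , here refl) → All.lookup (col∉ q) c∈ refl)
      ; inside = λ {y} y∈ → case-++ inside (subst (y ∈_) (verts-∷ʳ path px) y∈)
      ; colours⊆ = λ {c} c∈ → case-++ colours⊆ (subst (c ∈_) colours≡ c∈) }
      where
      q : InsidePath S h used a p
      q = paths a∈ p∈S
      open InsidePath q
      px : Edge G p x
      px = Edge-sym G xp
      colours≡ : map h′ (keys (path ++ʷ [ px ]ʷ)) ≡ map h (keys path) ++ [ col ]
      colours≡ = begin
        map h′ (keys (path ++ʷ [ px ]ʷ))          ≡⟨ cong (map h′) (keys-++ʷ path [ px ]ʷ) ⟩
        map h′ (keys path ++ [ key p x ])         ≡⟨ map-++ h′ (keys path) _ ⟩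
        map h′ (keys path) ++ [ h′ (key p x) ]    ≡⟨ cong₂ (λ cs c → cs ++ [ c ]) (h′-old path inside) (trans (cong h′ (key-comm p x)) h′-new) ⟩
        map h (keys path) ++ [ col ]              ∎
        where open ≡-Reasoning
      case-++ : ∀ {A : Set} {xs ys : List A} {z y} → xs ⊆ ys → y ∈ xs ++ [ z ] → y ∈ z ∷ ys
      case-++ {xs = xs} xs⊆ys y∈ with ∈-++⁻ xs y∈
      ... | inj₁ y∈xs        = there (xs⊆ys y∈xs)
      ... | inj₂ (here refl) = here refl

    paths′ : ∀ {a b} → a ∈ x ∷ S → b ∈ x ∷ S → InsidePath (x ∷ S) h′ (col ∷ used) a b
    paths′ (here refl) (here refl) = record
      { path = nil ; isPath = [] ∷ [] ; rainbow = [] ; inside = λ { (here refl) → here refl } ; colours⊆ = λ () }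
    paths′ (here refl) (there b∈) = from-x b∈
    paths′ (there a∈)  (here refl) = to-x a∈
    paths′ (there a∈)  (there b∈) = old a∈ b∈

    grown′ : Grown (x ∷ S)
    grown′ = record
      { S-unique = x∷S-unique ; h = h′ ; h∈L = h′∈L ; used = col ∷ used ; used<S = s≤s used<S ; paths = paths′ }

  grow-step : ∀ {S x p} → Grown S → x ∉ S → p ∈ S → Edge G x p → Grown (x ∷ S)
  grow-step = GrowStep.grown′

  module _ (connected : Connected G) where

    private
      crossing : ∀ {S a y} → Walk (adj G) a y → a ∈ S → y ∉ S → ∃ λ x → ∃ λ p → x ∉ S × p ∈ S × Edge G x p
      crossing nil a∈S y∉S = contradiction a∈S y∉S
      crossing {S} (cons aw q) a∈S y∉S with _ ∈ᶠ? S
      ... | yes w∈S = crossing q w∈S y∉S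
      ... | no  w∉S = _ , _ , w∉S , a∈S , Edge-sym G aw

      grow : ∀ fuel {S r} → Grown S → r ∈ S → n ≤ fuel + length S → ∃ λ S → Grown S × (∀ v → v ∈ S)
      grow fuel {S} {r} grown r∈S n≤ with Finₚ.any? (λ v → ¬? (v ∈ᶠ? S))
      ... | no ∄outside = S , grown , λ v → decidable-stable (v ∈ᶠ? S) (λ v∉S → ∄outside (v , v∉S))
      ... | yes (y , y∉S) with crossing (connected r y) r∈S y∉S | fuel
      ... | x , p , x∉S , p∈S , xp | zero     = contradiction
        (≤-trans (unique-Fin⇒length≤ (Grown.S-unique (grow-step grown x∉S p∈S xp))) n≤) (n≮n (length S))
      ... | x , p , x∉S , p∈S , xp | suc fuel =
        grow fuel (grow-step grown x∉S p∈S xp) (there r∈S) (subst (n ≤_) (sym (+-suc fuel (length S))) n≤)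

    spanningColouring : Fin n → 1 ≤ n ∸ 1 → Σ (Fin n → Fin n → ℕ) λ c → LColouring G L c × RainbowConnected G c
    spanningColouring r 1≤n-1 with grow n (grown-singleton 1≤n-1 r) (here refl) (m≤m+n n 1)
    ... | S , grown , all∈S = keyed h , keyed-LColouring G h (proj₁ isL) h∈L , λ u v →
      let open InsidePath (paths (all∈S u) (all∈S v)) in
      path , isPath , subst Unique (sym (edgeColours-keyed h path)) rainbow
      where open Grown grown

RCL-n∸1 : ∀ {n} (G : Graph n) → 2 ≤ n → Connected G → RCL G (n ∸ 1)
RCL-n∸1 {suc (suc _)} G (s≤s (s≤s _)) connected L isL = spanningColouring G isL connected Fin.zero (s≤s z≤n)

-- Bridges

module _ {n : ℕ} (G : Graph n) (i j : Fin n) where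

  private
    G-e : Fin n → Fin n → Bool
    G-e = delEdgeAdj G i j

  delEdge-spec : ∀ a b → ((a , b) ≐ (i , j) × G-e a b ≡ false) ⊎ (¬ (a , b) ≐ (i , j) × G-e a b ≡ adj G a b)
  delEdge-spec a b with a ≟ᶠ i | b ≟ᶠ j | a ≟ᶠ j | b ≟ᶠ i
  ... | yes a≡i | yes b≡j | _       | _       = inj₁ (inj₁ (a≡i , b≡j) , refl)
  ... | no  a≢i | _       | yes a≡j | yes b≡i = inj₁ (inj₂ (a≡j , b≡i) , refl)
  ... | yes a≡i | no  b≢j | yes a≡j | yes b≡i = inj₁ (inj₂ (a≡j , b≡i) , refl)
  ... | no  a≢i | _       | no  a≢j | _       = inj₂ ((λ where (inj₁ (a≡i , _)) → a≢i a≡i ; (inj₂ (a≡j , _)) → a≢j a≡j) , refl)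
  ... | no  a≢i | _       | yes _   | no  b≢i = inj₂ ((λ where (inj₁ (a≡i , _)) → a≢i a≡i ; (inj₂ (_ , b≡i)) → b≢i b≡i) , refl)
  ... | yes _   | no  b≢j | no  a≢j | _       = inj₂ ((λ where (inj₁ (_ , b≡j)) → b≢j b≡j ; (inj₂ (a≡j , _)) → a≢j a≡j) , refl)
  ... | yes _   | no  b≢j | yes _   | no  b≢i = inj₂ ((λ where (inj₁ (_ , b≡j)) → b≢j b≡j ; (inj₂ (_ , b≡i)) → b≢i b≡i) , refl)

  delEdge⇒Edge : ∀ {a b} → G-e a b ≡ true → Edge G a b
  delEdge⇒Edge {a} {b} ab with delEdge-spec a b
  ... | inj₁ (_ , ab≡false) = contradiction (trans (sym ab) ab≡false) λ ()
  ... | inj₂ (_ , ab≡adj)   = trans (sym ab≡adj) ab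

  delEdge-≭ : ∀ {a b} → G-e a b ≡ true → ¬ (a , b) ≐ (i , j)
  delEdge-≭ {a} {b} ab with delEdge-spec a b
  ... | inj₁ (_ , ab≡false) = contradiction (trans (sym ab) ab≡false) λ ()
  ... | inj₂ (ab≭ij , _)    = ab≭ij

  Edge⇒delEdge : ∀ {a b} → Edge G a b → ¬ (a , b) ≐ (i , j) → G-e a b ≡ true
  Edge⇒delEdge {a} {b} ab ab≭ij with delEdge-spec a b
  ... | inj₁ (ab≐ij , _) = contradiction ab≐ij ab≭ij
  ... | inj₂ (_ , ab≡adj) = trans ab≡adj ab

  delEdge-sym : ∀ {a b} → G-e a b ≡ true → G-e b a ≡ true
  delEdge-sym {a} {b} ab = Edge⇒delEdge (Edge-sym G (delEdge⇒Edge {a} {b} ab)) (delEdge-≭ {a} {b} ab ∘ ≐-swapˡ)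

  reverseᵉ : ∀ {a b} → Walk G-e a b → Walk G-e b a
  reverseᵉ = reverseʷ {A = G-e} λ {a} {b} → delEdge-sym {a} {b}

  firstUse : ∀ {a b} (p : Walk (adj G) a b) →
             Walk G-e a b ⊎ ∃ λ x → ∃ λ y → (x , y) ≐ (i , j) × (x , y) ∈ edges p × Walk G-e a x
  firstUse nil = inj₁ nil
  firstUse (cons {u = a} {w = w} aw p) with ≐-dec _≟ᶠ_ (a , w) (i , j) | firstUse p
  ... | yes aw≐ij | _                               = inj₂ (a , w , aw≐ij , here refl , nil)
  ... | no  aw≭ij | inj₁ q                          = inj₁ (cons (Edge⇒delEdge aw aw≭ij) q)
  ... | no  aw≭ij | inj₂ (x , y , xy≐ij , xy∈ , q) = inj₂ (x , y , xy≐ij , there xy∈ , cons (Edge⇒delEdge aw aw≭ij) q)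

  otherEnd-reaches : ∀ {i′ j′ o t x} → Edge G i′ j′ → ¬ (i′ , j′) ≐ (i , j) → (o , t) ≐ (i′ , j′) →
                     Walk G-e i′ x → Walk G-e o x
  otherEnd-reaches _    _      (inj₁ (refl , refl)) q = q
  otherEnd-reaches i′j′ i′j′≭ (inj₂ (refl , refl)) q = cons (Edge⇒delEdge (Edge-sym G i′j′) (i′j′≭ ∘ ≐-swapˡ)) q

  module _ (connected : Connected G) where

    reachEndpoint : ∀ x → ∃ λ o → ∃ λ t → (o , t) ≐ (i , j) × Walk G-e x t
    reachEndpoint x with firstUse (connected x i)
    ... | inj₁ q                                    = j , i , inj₂ (refl , refl) , q
    ... | inj₂ (_ , _ , inj₁ (refl , refl) , _ , q) = j , i , inj₂ (refl , refl) , q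
    ... | inj₂ (_ , _ , inj₂ (refl , refl) , _ , q) = i , j , inj₁ (refl , refl) , q

    bridge⇒¬walk : IsBridge G i j → ∀ {o t} → (o , t) ≐ (i , j) → ¬ Walk G-e o t
    bridge⇒¬walk (_ , disconnected) o-t = disconnected ∘ connects o-t
      where
      connects : ∀ {o t} → (o , t) ≐ (i , j) → Walk G-e o t → ConnectedAdj G-e
      connects (inj₂ (refl , refl)) q = connects (inj₁ (refl , refl)) (reverseᵉ q)
      connects (inj₁ (refl , refl)) q a b with reachEndpoint a | reachEndpoint b
      ... | _ , _ , inj₁ (refl , refl) , qa | _ , _ , inj₁ (refl , refl) , qb = qa ++ʷ reverseᵉ qb
      ... | _ , _ , inj₁ (refl , refl) , qa | _ , _ , inj₂ (refl , refl) , qb = qa ++ʷ reverseᵉ q ++ʷ reverseᵉ qb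
      ... | _ , _ , inj₂ (refl , refl) , qa | _ , _ , inj₁ (refl , refl) , qb = qa ++ʷ q ++ʷ reverseᵉ qb
      ... | _ , _ , inj₂ (refl , refl) , qa | _ , _ , inj₂ (refl , refl) , qb = qa ++ʷ reverseᵉ qb

    bridge-crossed : IsBridge G i j → ∀ {o t a b} → (o , t) ≐ (i , j) → Walk G-e a o → Walk G-e b t →
                     (p : Walk (adj G) a b) → ∃ λ x → ∃ λ y → (x , y) ≐ (i , j) × (x , y) ∈ edges p
    bridge-crossed bridge o-t ao bt p with firstUse p
    ... | inj₁ q                         = contradiction (reverseᵉ ao ++ʷ q ++ʷ bt) (bridge⇒¬walk bridge o-t)
    ... | inj₂ (x , y , xy≐ij , xy∈ , _) = x , y , xy≐ij , xy∈

≐⇒colour≡ : ∀ {n} {G : Graph n} {c : Fin n → Fin n → ℕ} → SymOnEdges G c → ∀ {x y i j} → Edge G i j → (x , y) ≐ (i , j) → c x y ≡ c i j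
≐⇒colour≡ c-sym ij (inj₁ (refl , refl)) = refl
≐⇒colour≡ c-sym ij (inj₂ (refl , refl)) = sym (c-sym _ _ ij)

module _ {n : ℕ} (G : Graph n) (connected : Connected G) where

  -- a rainbow path between the far endpoints of two bridges must cross both of them
  bridge-colours-differ : ∀ {c : Fin n → Fin n → ℕ} → SymOnEdges G c → RainbowConnected G c → ∀ {i j i′ j′} → IsBridge G i j → IsBridge G i′ j′ →
                          ¬ (i , j) ≐ (i′ , j′) → c i j ≢ c i′ j′
  bridge-colours-differ {c} c-sym rc {i} {j} {i′} {j′} bridge bridge′ ij≭i′j′ c≡
    with reachEndpoint G i j connected i′ | reachEndpoint G i′ j′ connected i
  ... | o₁ , t₁ , o₁t₁≐ , i′→t₁ | o₂ , t₂ , o₂t₂≐ , i→t₂ with rc o₁ o₂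
  ... | P , _ , rainbow
    with bridge-crossed G i j connected bridge o₁t₁≐ nil
           (otherEnd-reaches G i j (proj₁ bridge′) (ij≭i′j′ ∘ ≐-sym) o₂t₂≐ i′→t₁) P
       | bridge-crossed G i′ j′ connected bridge′ (≐-swapˡ o₂t₂≐)
           (otherEnd-reaches G i′ j′ (proj₁ bridge) ij≭i′j′ o₁t₁≐ i→t₂) nil P
  ... | x , y , xy≐ , xy∈ | x′ , y′ , x′y′≐ , x′y′∈ =
    ij≭i′j′ (≐-trans (≐-sym xy≐) (subst (_≐ (i′ , j′)) (sym xy≡x′y′) x′y′≐))
    where
    xy≡x′y′ : (x , y) ≡ (x′ , y′)
    xy≡x′y′ = unique-map⇒injective (subst Unique (edgeColours≡ c P) rainbow) xy∈ x′y′∈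
      (trans (≐⇒colour≡ {G = G} c-sym (proj₁ bridge) xy≐) (trans c≡ (sym (≐⇒colour≡ {G = G} c-sym (proj₁ bridge′) x′y′≐))))

  sortedBridges≤ : ∀ {k} → RC G k → (bs : List (Fin n × Fin n)) → Unique bs →
                   (∀ {i j} → (i , j) ∈ bs → toℕ i < toℕ j × IsBridge G i j) → length bs ≤ k
  sortedBridges≤ {k} (c , (c-sym , c<k) , rc) bs !bs sorted-bridges = begin
    length bs                    ≡⟨ length-map (uncurry c) bs ⟨
    length (map (uncurry c) bs)  ≤⟨ unique⊆⇒length≤ (unique-map⁺ !bs colour-inj) (∈-upTo⁺ ∘ colour<k) ⟩
    length (upTo k)              ≡⟨ length-upTo k ⟩
    k                            ∎
    where
    open ≤-Reasoning
    colour-inj : ∀ {x y} → x ∈ bs → y ∈ bs → uncurry c x ≡ uncurry c y → x ≡ y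
    colour-inj {i , j} {i′ , j′} ij∈ i′j′∈ c≡ with (i , j) ≟ᵏ (i′ , j′)
    ... | yes ij≡i′j′ = ij≡i′j′
    ... | no  ij≢i′j′ = contradiction c≡
      (bridge-colours-differ c-sym rc (proj₂ (sorted-bridges ij∈)) (proj₂ (sorted-bridges i′j′∈)) ij≭i′j′)
      where
      ij≭i′j′ : ¬ (i , j) ≐ (i′ , j′)
      ij≭i′j′ (inj₁ (refl , refl)) = ij≢i′j′ refl
      ij≭i′j′ (inj₂ (refl , refl)) = <-asym (proj₁ (sorted-bridges ij∈)) (proj₁ (sorted-bridges i′j′∈))
    colour<k : ∀ {x} → x ∈ map (uncurry c) bs → x < k
    colour<k x∈ with ∈-map⁻ (uncurry c) x∈
    ... | (i , j) , ij∈ , refl = c<k i j (proj₁ (proj₂ (sorted-bridges ij∈)))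

tree⇒bridge : ∀ {n} {G : Graph n} → IsTree G → ∀ {i j} → Edge G i j → IsBridge G i j
tree⇒bridge {G = G} (_ , acyclic) {i} {j} ij = ij , λ connected-e →
  let open PathWithin (shortcut (connected-e i j)) in
  acyclic (i , j , mapʷ (λ x → x) (delEdge⇒Edge G i j) path ,
           subst Unique (sym (trans (verts-mapʷ _ _ path) (map-id (verts path)))) isPath ,
           subst (2 ≤_) (sym (len-mapʷ _ _ path)) (2≤len path) , Edge-sym G ij)
  where
  2≤len : (p : Walk (delEdgeAdj G i j) i j) → 2 ≤ len p
  2≤len nil                 = contradiction refl (Edge⇒≢ G ij)
  2≤len (cons ij-e nil)     = contradiction (inj₁ (refl , refl)) (delEdge-≭ G i j ij-e)
  2≤len (cons _ (cons _ _)) = s≤s (s≤s z≤n)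

-- Cut vertices

unpunch : ∀ {m} (v w : Fin (suc m)) → w ≢ v → ∃ λ w′ → punchIn v w′ ≡ w
unpunch v w w≢v = punchOut (w≢v ∘ sym) , Finₚ.punchIn-punchOut (w≢v ∘ sym)

module _ {m : ℕ} (G : Graph (suc m)) (v : Fin (suc m)) where

  private
    H : Graph m
    H = removeVertex G v

  lastBefore : ∀ {x} → Walk (adj G) x v → ∀ a → x ≡ punchIn v a → ∃ λ b → Walk (adj H) a b × Edge G (punchIn v b) v
  lastBefore nil a x≡ = contradiction (sym x≡) (Finₚ.punchInᵢ≢i v a)
  lastBefore (cons {w = w} xw p) a refl with w ≟ᶠ v
  ... | yes refl = a , nil , xw
  ... | no  w≢v with unpunch v w w≢v
  ...   | w′ , refl with lastBefore p w′ refl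
  ...     | b , q , bv = b , cons xw q , bv

  -- two neighbours a, b of v that are disconnected in G − v are at distance 2, and every geodesic between them passes through v
  cut-colours-differ : ∀ {c} → SymOnEdges G c → StronglyRainbowConnected G c → ∀ {a b} →
                       Edge G (punchIn v a) v → Edge G (punchIn v b) v → ¬ Walk (adj H) a b → c (punchIn v a) v ≢ c (punchIn v b) v
  cut-colours-differ {c} c-sym src {a} {b} av bv disconnected c≡ = geodesic-through-v refl refl (src (punchIn v a) (punchIn v b))
    where
    ends≢ : punchIn v a ≢ punchIn v b
    ends≢ eq = disconnected (subst (Walk (adj H) a) (Finₚ.punchIn-injective v _ _ eq) nil)
    via-v : Walk (adj G) (punchIn v a) (punchIn v b)
    via-v = cons av [ Edge-sym G bv ]ʷ
    via-v-path : IsPath via-v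
    via-v-path = (Finₚ.punchInᵢ≢i v _ ∷ ends≢ ∷ []) ∷ ((Finₚ.punchInᵢ≢i v _ ∘ sym) ∷ []) ∷ [] ∷ []
    geodesic-through-v : ∀ {x y} → x ≡ punchIn v a → y ≡ punchIn v b →
                         (∃ λ (P : Walk (adj G) x y) → Geodesic P × Rainbow c P) → ⊥
    geodesic-through-v refl y≡ (nil , _) = ends≢ y≡
    geodesic-through-v refl refl (cons xy nil , _) = disconnected [ xy ]ʷ
    geodesic-through-v refl refl (cons {w = w} xw (cons wy nil) , _ , (c≢ ∷ []) ∷ _) with w ≟ᶠ v
    ... | yes refl = c≢ (trans c≡ (c-sym _ _ bv))
    ... | no  w≢v with unpunch v w w≢v
    ...   | w′ , refl = disconnected (cons xw [ wy ]ʷ)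
    geodesic-through-v refl refl (cons _ (cons _ (cons _ _)) , (_ , P-min) , _) with P-min via-v via-v-path
    ... | s≤s (s≤s ())

  components≤src : Connected G → ∀ {q s} → HasComponents H q → SRC G s → q ≤ s
  components≤src connected {q} {s} (comp , comp-onto , comp-walk) (c , (c-sym , c<s) , src) = begin
    q                                   ≡⟨ length-tabulate {n = q} (λ i → i) ⟨
    length (allFin q)                   ≡⟨ length-map f (allFin q) ⟨
    length (map f (allFin q))           ≤⟨ unique⊆⇒length≤ (unique-map⁺ (Uniqueₚ.allFin⁺ q) λ _ _ → f-inj) (∈-upTo⁺ ∘ f<s) ⟩
    length (upTo s)                     ≡⟨ length-upTo s ⟩
    s                                   ∎
    where
    open ≤-Reasoning
    nbr : ∀ y → ∃ λ b → Walk (adj H) (proj₁ (comp-onto y)) b × Edge G (punchIn v b) v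
    nbr y = lastBefore (connected _ v) (proj₁ (comp-onto y)) refl
    b : Fin q → Fin m
    b y = proj₁ (nbr y)
    comp-b : ∀ y → comp (b y) ≡ y
    comp-b y = trans (sym (proj₂ (comp-walk _ _) (proj₁ (proj₂ (nbr y))))) (proj₂ (comp-onto y))
    bv : ∀ y → Edge G (punchIn v (b y)) v
    bv y = proj₂ (proj₂ (nbr y))
    f : Fin q → ℕ
    f y = c (punchIn v (b y)) v
    f<s : ∀ {x} → x ∈ map f (allFin q) → x < s
    f<s x∈ with ∈-map⁻ f x∈
    ... | y , _ , refl = c<s _ _ (bv y)
    f-inj : ∀ {y y′} → f y ≡ f y′ → y ≡ y′
    f-inj {y} {y′} f≡ with y ≟ᶠ y′
    ... | yes y≡y′ = y≡y′
    ... | no  y≢y′ = contradiction f≡ (cut-colours-differ c-sym src (bv y) (bv y′) λ q →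
                       y≢y′ (trans (sym (comp-b y)) (trans (proj₂ (comp-walk _ _) q) (comp-b y′))))

-- Pendant vertices

module _ {m : ℕ} (G : Graph (suc m)) (w : Fin (suc m)) (pendant : degree G w ≡ 1) where

  private
    H : Graph m
    H = removeVertex G w
    ↑ : Fin m → Fin (suc m)
    ↑ = punchIn w
    ↑-adj : ∀ {a b} → adj H a b ≡ true → Edge G (↑ a) (↑ b)
    ↑-adj ab = ab

  neighbour-unique : ∀ {x y} → Edge G w x → Edge G w y → x ≡ y
  neighbour-unique {x} {y} wx wy with x ≟ᶠ y
  ... | yes x≡y = x≡y
  ... | no  x≢y = contradiction (subst (2 ≤_) pendant two≤degree) λ where (s≤s ())
    where
    two≤degree : 2 ≤ degree G w
    two≤degree = unique⊆⇒length≤ ((x≢y ∷ []) ∷ [] ∷ []) λ where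
      (here refl)         → ∈-filter⁺ (λ j → adj G w j ≟ᵇ true) (∈-allFin x) wx
      (there (here refl)) → ∈-filter⁺ (λ j → adj G w j ≟ᵇ true) (∈-allFin y) wy

  -- an inner vertex of a path has two distinct neighbours on it
  path-avoids : ∀ {x z} (P : Walk (adj G) x z) → IsPath P → x ≢ w → z ≢ w → w ∉ verts P
  path-avoids nil          _           x≢w _   (here w≡x)          = x≢w (sym w≡x)
  path-avoids (cons _ _)   _           x≢w _   (here w≡x)          = x≢w (sym w≡x)
  path-avoids (cons _ nil) _           _   z≢w (there (here w≡z))  = z≢w (sym w≡z)
  path-avoids (cons {w = u} xu P@(cons ut _)) (x∉P ∷ !P) x≢w z≢w (there w∈P) with u ≟ᶠ w
  ... | no  u≢w  = path-avoids P !P u≢w z≢w w∈P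
  ... | yes refl = All.lookup x∉P (there (start∈verts _)) (neighbour-unique (Edge-sym G xu) ut)

  module _ (c : Fin (suc m) → Fin (suc m) → ℕ) where

    private
      c↑ : Fin m → Fin m → ℕ
      c↑ a b = c (↑ a) (↑ b)

    unlift : ∀ {x z} (P : Walk (adj G) x z) → w ∉ verts P → ∀ {a b} → x ≡ ↑ a → z ≡ ↑ b →
             ∃ λ (Q : Walk (adj H) a b) → map ↑ (verts Q) ≡ verts P × len Q ≡ len P × edgeColours c↑ Q ≡ edgeColours c P
    unlift nil _ refl z≡ with Finₚ.punchIn-injective w _ _ z≡
    ... | refl = nil , refl , refl , refl
    unlift (cons {w = u} xu P) w∉ refl refl with unpunch w u (λ where refl → w∉ (there (start∈verts P)))
    ... | u′ , refl with unlift P (w∉ ∘ there) refl refl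
    ...   | Q , verts≡ , len≡ , colours≡ = cons xu Q , cong (_ ∷_) verts≡ , cong suc len≡ , cong (_ ∷_) colours≡

    liftPath : ∀ {a b} (P : Walk (adj G) (↑ a) (↑ b)) → IsPath P →
               ∃ λ (Q : Walk (adj H) a b) → IsPath Q × len Q ≡ len P × edgeColours c↑ Q ≡ edgeColours c P
    liftPath {a} {b} P !P with unlift P (path-avoids P !P (Finₚ.punchInᵢ≢i w a) (Finₚ.punchInᵢ≢i w b)) refl refl
    ... | Q , verts≡ , len≡ , colours≡ = Q , Uniqueₚ.map⁻ (subst Unique (sym verts≡) !P) , len≡ , colours≡

  private
    restrict : ∀ {k c} → UsesColours G k c → UsesColours H k (λ x y → c (↑ x) (↑ y))
    restrict (c-sym , c<k) = (λ x y → c-sym (↑ x) (↑ y)) , (λ x y → c<k (↑ x) (↑ y))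

  RC-removePendant : ∀ {k} → RC G k → RC H k
  RC-removePendant (c , uses , rc) = _ , restrict uses , λ a b →
    let P , !P , rainbow = rc (↑ a) (↑ b) ; Q , !Q , _ , colours≡ = liftPath c P !P in
    Q , !Q , subst Unique (sym colours≡) rainbow

  lowerPath : ∀ {a b} (Q : Walk (adj H) a b) → IsPath Q → ∃ λ (P : Walk (adj G) (↑ a) (↑ b)) → IsPath P × len P ≡ len Q
  lowerPath Q !Q = mapʷ ↑ ↑-adj Q ,
    subst Unique (sym (verts-mapʷ ↑ ↑-adj Q)) (Uniqueₚ.map⁺ (Finₚ.punchIn-injective w _ _) !Q) , len-mapʷ ↑ ↑-adj Q

  SRC-removePendant : ∀ {k} → SRC G k → SRC H k
  SRC-removePendant (c , uses , src) = _ , restrict uses , λ a b →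
    let P , (!P , P-min) , rainbow = src (↑ a) (↑ b) ; Q , !Q , len≡ , colours≡ = liftPath c P !P in
    Q , (!Q , λ Q′ !Q′ → let P′ , !P′ , len≡′ = lowerPath Q′ !Q′ in
                         subst₂ _≤_ (sym len≡) len≡′ (P-min P′ !P′)) ,
    subst Unique (sym colours≡) rainbow

-- Cycles

module _ {n : ℕ} (G : Graph n) where

  record Cycle : Set where
    field
      {start end} : Fin n
      path        : Walk (adj G) start end
      isPath      : IsPath path
      long        : 2 ≤ len path
      closing     : Edge G end start

    size : ℕ
    size = suc (len path)

  private
    rev : ∀ {a b} → Walk (adj G) a b → Walk (adj G) b a
    rev = reverseʷ (Edge-sym G)

  -- two paths of different lengths between the same ends diverge somewhere, closing a cycle
  twoPaths⇒cycle : ∀ {x y} (P Q : Walk (adj G) x y) → IsPath P → IsPath Q → len P ≢ len Q →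
                   Σ Cycle λ C → Cycle.size C ≤ len P + len Q
  twoPaths⇒cycle nil nil _ _ P≢Q = contradiction refl P≢Q
  twoPaths⇒cycle nil (cons _ Q) _ (x∉Q ∷ _) _ = contradiction refl (All.lookup x∉Q (end∈verts Q))
  twoPaths⇒cycle (cons _ P) nil (x∉P ∷ _) _ _ = contradiction refl (All.lookup x∉P (end∈verts P))
  twoPaths⇒cycle {x} (cons {w = a} xa P) (cons {w = b} xb Q) (x∉P ∷ !P) (x∉Q ∷ !Q) P≢Q with a ≟ᶠ b
  ... | yes refl = let C , C≤ = twoPaths⇒cycle P Q !P !Q (P≢Q ∘ cong suc) in
    C , ≤-trans C≤ (+-mono-≤ (n≤1+n (len P)) (n≤1+n (len Q)))
  ... | no  a≢b = record
    { path = cons xa path ; isPath = x∉R ∷ isPath ; long = s≤s (1≤len path a≢b) ; closing = Edge-sym G xb } ,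
    (begin
      suc (suc (len path))              ≤⟨ s≤s (s≤s len≤) ⟩
      suc (suc (len (P ++ʷ rev Q)))     ≡⟨ cong (suc ∘ suc) (trans (len-++ʷ P (rev Q)) (cong (len P +_) (len-reverseʷ (Edge-sym G) Q))) ⟩
      suc (suc (len P + len Q))         ≡⟨ cong suc (+-suc (len P) (len Q)) ⟨
      suc (len P) + suc (len Q)         ∎)
    where
    open ≤-Reasoning
    open PathWithin (shortcut (P ++ʷ rev Q))
    x∉R : All (x ≢_) (verts path)
    x∉R = All.tabulate λ z∈ x≡z → case ∈-verts-++ʷ⁻ P (rev Q) (verts⊆ z∈) of λ where
      (inj₁ z∈P)  → All.lookup x∉P z∈P x≡z
      (inj₂ z∈rQ) → All.lookup x∉Q (∈-verts-reverseʷ (Edge-sym G) Q z∈rQ) x≡z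
    1≤len : ∀ {a b} (R : Walk (adj G) a b) → a ≢ b → 1 ≤ len R
    1≤len nil        a≢b = contradiction refl a≢b
    1≤len (cons _ _) _   = s≤s z≤n

  -- the cycle  c₀ c₁ ⋯A⋯ cₖ cₖ₊₁ ⋯B⋯ c₀  cut into two arcs whose lengths differ by at most one
  record SplitCycle : Set where
    field
      {c₀ c₁ cₖ cₖ₊₁} : Fin n
      e₀     : Edge G c₀ c₁
      eₖ     : Edge G cₖ cₖ₊₁
      A      : Walk (adj G) c₁ cₖ
      B      : Walk (adj G) cₖ₊₁ c₀
      A-path : IsPath (cons e₀ (A ++ʷ [ eₖ ]ʷ))
      B-path : IsPath B
      A≤B    : len A ≤ len B
      B≤1+A  : len B ≤ suc (len A)

    size : ℕ
    size = suc (suc (len A + len B))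

  private
    halves : ∀ {a b} → a ≡ ⌊ a + b /2⌋ → a ≤ b × b ≤ suc a
    halves {a} {b} a≡ = subst₂ _≤_ (sym a≡) (sym b≡) (⌊n/2⌋≤⌈n/2⌉ (a + b)) ,
                        subst₂ _≤_ (sym b≡) (cong suc (sym a≡)) (⌊n/2⌋-mono (n≤1+n (suc (a + b))))
      where
      b≡ : b ≡ ⌈ a + b /2⌉
      b≡ = +-cancelˡ-≡ a b _ (trans (sym (⌊n/2⌋+⌈n/2⌉≡n (a + b))) (cong (_+ ⌈ a + b /2⌉) (sym a≡)))

  splitCycle : (C : Cycle) → Σ SplitCycle λ D → SplitCycle.size D ≡ Cycle.size C
  splitCycle record { path = cons e₀ P ; isPath = !P ; long = s≤s 1≤P ; closing = closing }
    with splitAtLength P ⌊ len P /2⌋ (⌊n/2⌋≤n (len P))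
  ... | _ , A , nil , lenA , refl = contradiction (sym A≡⌊A/2⌋) (<⇒≢ (⌊n/2⌋<n′ 1≤A))
    where
    lenA+0 : len (A ++ʷ nil) ≡ len A
    lenA+0 = trans (len-++ʷ A nil) (+-identityʳ (len A))
    A≡⌊A/2⌋ : len A ≡ ⌊ len A /2⌋
    A≡⌊A/2⌋ = trans lenA (cong ⌊_/2⌋ lenA+0)
    1≤A : 1 ≤ len A
    1≤A = subst (1 ≤_) lenA+0 1≤P
    ⌊n/2⌋<n′ : ∀ {m} → 1 ≤ m → ⌊ m /2⌋ < m
    ⌊n/2⌋<n′ {suc m} _ = ⌊n/2⌋<n m
  ... | _ , A , cons eₖ B , lenA , refl = record
    { e₀ = e₀ ; eₖ = eₖ ; A = A ; B = B ++ʷ [ closing ]ʷ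
    ; A-path = isPath-++ʷˡ (cons e₀ (A ++ʷ [ eₖ ]ʷ)) B !P′
    ; B-path = isPath-∷ʳ B closing (isPath-++ʷʳ (cons e₀ (A ++ʷ [ eₖ ]ʷ)) B !P′)
                 λ c₀∈B → All.lookup (head-fresh !P) (∈-verts-++ʷ⁺ʳ A (cons eₖ B) (there c₀∈B)) refl
    ; A≤B = subst (len A ≤_) (sym lenB) (proj₁ balanced)
    ; B≤1+A = subst (_≤ suc (len A)) (sym lenB) (proj₂ balanced)
    } , cong (suc ∘ suc) (trans (cong (len A +_) lenB) (sym (len-++ʷ A (cons eₖ B))))
    where
    !P′ : IsPath (cons e₀ (A ++ʷ [ eₖ ]ʷ) ++ʷ B)
    !P′ = subst IsPath (cong (cons e₀) (sym (++ʷ-assoc A [ eₖ ]ʷ B))) !P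
    head-fresh : ∀ {x xs} → Unique (x ∷ xs) → All (x ≢_) xs
    head-fresh (x∉ ∷ _) = x∉
    lenB : len (B ++ʷ [ closing ]ʷ) ≡ suc (len B)
    lenB = trans (len-++ʷ B [ closing ]ʷ) (+-comm (len B) 1)
    balanced : len A ≤ suc (len B) × suc (len B) ≤ suc (len A)
    balanced = halves (trans lenA (cong ⌊_/2⌋ (len-++ʷ A (cons eₖ B))))

  module Arcs (D : SplitCycle) where
    open SplitCycle D

    s t : Bool → Fin n
    s false = c₀
    s true  = c₁
    t false = cₖ
    t true  = cₖ₊₁

    -- the length of the shorter arc of the cycle from s x to t y
    d : Bool → Bool → ℕ
    d false false = suc (len A)
    d false true  = len B
    d true  false = len A
    d true  true  = suc (len A)

    arc : ∀ x y → ∃ λ (W : Walk (adj G) (s x) (t y)) → IsPath W × len W ≡ d x y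
    arc false false = cons e₀ A , isPath-++ʷˡ (cons e₀ A) [ eₖ ]ʷ A-path , refl
    arc false true  = rev B , isPath-reverseʷ (Edge-sym G) B B-path , len-reverseʷ (Edge-sym G) B
    arc true  false = A , isPath-++ʷˡ A [ eₖ ]ʷ (isPath-++ʷʳ [ e₀ ]ʷ (A ++ʷ [ eₖ ]ʷ) A-path) , refl
    arc true  true  = A ++ʷ [ eₖ ]ʷ , isPath-++ʷʳ [ e₀ ]ʷ (A ++ʷ [ eₖ ]ʷ) A-path ,
                      trans (len-++ʷ A [ eₖ ]ʷ) (+-comm (len A) 1)

    d-twice : ∀ x y → d x y + d x y ≤ size
    d-twice false false = s≤s (subst (_≤ suc (len A + len B)) (sym (+-suc (len A) (len A))) (s≤s (+-monoʳ-≤ (len A) A≤B)))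
    d-twice false true  = m≤n⇒m≤1+n (+-monoˡ-≤ (len B) B≤1+A)
    d-twice true  false = m≤n⇒m≤1+n (m≤n⇒m≤1+n (+-monoʳ-≤ (len A) A≤B))
    d-twice true  true  = d-twice false false

    d-cross : ∀ x y → d x (not y) < d (not x) y + 2
    d-cross false false = subst (len B <_) (sym (+-comm (len A) 2)) (s≤s B≤1+A)
    d-cross false true  = m<m+n (suc (len A)) (s≤s z≤n)
    d-cross true  false = m<m+n (suc (len A)) (s≤s z≤n)
    d-cross true  true  = subst (len A <_) (sym (+-comm (len B) 2)) (s≤s (m≤n⇒m≤1+n A≤B))

    Isometric : Set
    Isometric = ∀ x y (W : Walk (adj G) (s x) (t y)) → d x y ≤ len W

    -- a walk shorter than an arc closes, together with that arc, a cycle shorter than this one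
    isometric-or-shorter : Isometric ⊎ Σ Cycle λ C → Cycle.size C < size
    isometric-or-shorter = allBool² check
      where
      check : ∀ x y → (∀ W → d x y ≤ len W) ⊎ Σ Cycle λ C → Cycle.size C < size
      check x y with arc x y
      ... | W₀ , !W₀ , lenW₀ with shortest W₀
      ... | W , !W , W-min with d x y ≤? len W
      ... | yes d≤W = inj₁ λ W′ → ≤-trans d≤W (W-min W′)
      ... | no  d≰W = let W<d = ≰⇒> d≰W ; C , C≤ = twoPaths⇒cycle W₀ W !W₀ !W (λ eq → <⇒≢ W<d (trans (sym eq) lenW₀)) in
        inj₂ (C , (begin-strict
          Cycle.size C      ≤⟨ C≤ ⟩
          len W₀ + len W    <⟨ +-monoʳ-< (len W₀) W<d ⟩
          len W₀ + d x y    ≡⟨ cong (_+ d x y) lenW₀ ⟩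
          d x y + d x y     ≤⟨ d-twice x y ⟩
          size              ∎))
        where open ≤-Reasoning
      allBool² : ∀ {P : Bool → Bool → Set} {Q : Set} → (∀ x y → P x y ⊎ Q) → (∀ x y → P x y) ⊎ Q
      allBool² {P} p⊎q with p⊎q false false | p⊎q false true | p⊎q true false | p⊎q true true
      ... | inj₁ ff | inj₁ ft | inj₁ tf | inj₁ tt = inj₁ λ where
        false false → ff
        false true  → ft
        true  false → tf
        true  true  → tt
      ... | inj₂ q | _      | _      | _      = inj₂ q
      ... | _      | inj₂ q | _      | _      = inj₂ q
      ... | _      | _      | inj₂ q | _      = inj₂ q
      ... | _      | _      | _      | inj₂ q = inj₂ q

  isometricSplit : Cycle → Σ SplitCycle Arcs.Isometric
  isometricSplit C = go C (<-wellFounded (Cycle.size C))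
    where
    go : (C : Cycle) → Acc _<_ (Cycle.size C) → Σ SplitCycle Arcs.Isometric
    go C (acc smaller) with splitCycle C
    ... | D , D≡C with Arcs.isometric-or-shorter D
    ... | inj₁ isometric  = D , isometric
    ... | inj₂ (C′ , C′<) = go C′ (smaller (subst (Cycle.size C′ <_) D≡C C′<))

  record SeparatedEdges : Set where
    field
      f₁ f₂     : Fin n × Fin n
      f₁∈       : f₁ ∈ edgeList G
      f₂∈       : f₂ ∈ edgeList G
      f₁≢f₂     : f₁ ≢ f₂
      separated : ∀ {u v} {Q : Walk (adj G) u v} → Shortest Q → f₁ ∈ keys Q → f₂ ∈ keys Q → ⊥

  -- no shortest walk crosses both cut edges of an isometric split cycle: the part between them would be longer than an arc
  module _ (D : SplitCycle) (isometric : Arcs.Isometric D) where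
    open SplitCycle D
    open Arcs D

    private
      c₀∉ : All (c₀ ≢_) (verts (A ++ʷ [ eₖ ]ʷ))
      c₀∉ with A-path
      ... | c₀∉ ∷ _ = c₀∉
      c₀≢cₖ : c₀ ≢ cₖ
      c₀≢cₖ = All.lookup c₀∉ (∈-verts-++ʷ⁺ʳ A [ eₖ ]ʷ (here refl))
      c₀≢cₖ₊₁ : c₀ ≢ cₖ₊₁
      c₀≢cₖ₊₁ = All.lookup c₀∉ (end∈verts (A ++ʷ [ eₖ ]ʷ))
      cuts≭ : ¬ (c₀ , c₁) ≐ (cₖ , cₖ₊₁)
      cuts≭ (inj₁ (c₀≡cₖ , _))   = c₀≢cₖ c₀≡cₖ
      cuts≭ (inj₂ (c₀≡cₖ₊₁ , _)) = c₀≢cₖ₊₁ c₀≡cₖ₊₁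
      cuts≢ : ∀ x y → (t y , t (not y)) ≢ (s x , s (not x))
      cuts≢ false false eq = c₀≢cₖ (sym (cong proj₁ eq))
      cuts≢ false true  eq = c₀≢cₖ₊₁ (sym (cong proj₁ eq))
      cuts≢ true  false eq = c₀≢cₖ₊₁ (sym (cong proj₂ eq))
      cuts≢ true  true  eq = c₀≢cₖ (sym (cong proj₂ eq))

      ≐-ends : ∀ {a b} (f : Bool → Fin n) → (f false , f true) ≐ (a , b) → ∃ λ x → a ≡ f x × b ≡ f (not x)
      ≐-ends f (inj₁ (refl , refl)) = false , refl , refl
      ≐-ends f (inj₂ (refl , refl)) = true , refl , refl

      squeeze : ∀ {r w d′} → r + 2 ≤ w → w < d′ + 2 → d′ ≤ r → ⊥
      squeeze r+2≤w w<d′+2 d′≤r = <⇒≱ (≤-<-trans r+2≤w w<d′+2) (+-monoˡ-≤ 2 d′≤r)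

      not-both-crossed : ∀ {u v} {Q : Walk (adj G) u v} → Shortest Q → ∀ x y →
                  (s x , s (not x)) ∈ edges Q → (t y , t (not y)) ∈ edges Q → ⊥
      not-both-crossed {Q = Q} Q-shortest x y e∈ e′∈ with splitAtEdge Q e∈
      ... | Q₁ , e , Q₂ , refl with ∈-++⁻ (edges Q₁) (subst ((t y , t (not y)) ∈_) (edges-++ʷ Q₁ (cons e Q₂)) e′∈)
      ... | inj₂ (here same) = cuts≢ x y same
      ... | inj₂ (there e′∈Q₂) with splitAtEdge Q₂ e′∈Q₂
      ...   | R , e′ , T , refl =
        let W , _ , lenW = arc x (not y) in
        squeeze (shortest-segment Q-shortest Q₁ e R e′ T refl W) (subst (_< d (not x) y + 2) (sym lenW) (d-cross x y)) (isometric (not x) y R)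
      not-both-crossed {Q = Q} Q-shortest x y e∈ e′∈ | Q₁ , e , Q₂ , refl | inj₁ e′∈Q₁ with splitAtEdge Q₁ e′∈Q₁
      ...   | R , e′ , T , refl =
        let W , _ , lenW = arc (not x) y in
        squeeze (shortest-segment Q-shortest R e′ T e Q₂ (++ʷ-assoc R (cons e′ T) (cons e Q₂)) (rev W))
                (subst (_< d x (not y) + 2) (sym (trans (len-reverseʷ (Edge-sym G) W) lenW)) d<d+2)
                (subst (d x (not y) ≤_) (len-reverseʷ (Edge-sym G) T) (isometric x (not y) (rev T)))
        where
        d<d+2 : d (not x) y < d x (not y) + 2
        d<d+2 = subst₂ (λ x′ y′ → d (not x) y′ < d x′ (not y) + 2) (not-involutive x) (not-involutive y) (d-cross (not x) (not y))

      oriented-occurrence : ∀ {u v} (Q : Walk (adj G) u v) (f : Bool → Fin n) → key (f false) (f true) ∈ keys Q →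
                 ∃ λ x → (f x , f (not x)) ∈ edges Q
      oriented-occurrence Q f k∈ with ∈-map⁻ (uncurry key) k∈
      ... | _ , ab∈ , k≡ with ≐-ends f (key≡⇒≐ k≡)
      ... | x , refl , refl = x , ab∈

    isometric⇒separated : SeparatedEdges
    isometric⇒separated = record
      { f₁ = key c₀ c₁ ; f₂ = key cₖ cₖ₊₁ ; f₁∈ = key∈edgeList G e₀ ; f₂∈ = key∈edgeList G eₖ
      ; f₁≢f₂ = cuts≭ ∘ key≡⇒≐
      ; separated = λ {_} {_} {Q} Q-shortest f₁∈Q f₂∈Q →
          let x , e∈ = oriented-occurrence Q s f₁∈Q ; y , e′∈ = oriented-occurrence Q t f₂∈Q in not-both-crossed Q-shortest x y e∈ e′∈
      }

cycle⇒separatedEdges : ∀ {n} (G : Graph n) → HasCycle G → SeparatedEdges G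
cycle⇒separatedEdges G (_ , _ , P , !P , 2≤P , closing) =
  let D , isometric = isometricSplit G (record { path = P ; isPath = !P ; long = 2≤P ; closing = closing }) in
  isometric⇒separated G D isometric

separated⇒SRCL-e∸1 : ∀ {n} (G : Graph n) → Connected G → SeparatedEdges G → SRCL G (e G ∸ 1)
separated⇒SRCL-e∸1 {n} G connected separatedEdges L (L-sym , L-big) = keyed choose , keyed-LColouring G choose L-sym (choose∈ ∘ covers) , src
  where
  open SeparatedEdges separatedEdges
  others : List (Fin n × Fin n)
  others = filter (λ k → ¬? (k ≟ᵏ f₁) ×-dec ¬? (k ≟ᵏ f₂)) (edgeList G)
  covers : edgeList G ⊆ f₁ ∷ f₂ ∷ others
  covers {k} k∈ with k ≟ᵏ f₁ | k ≟ᵏ f₂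
  ... | yes k≡f₁ | _        = here k≡f₁
  ... | no  _    | yes k≡f₂ = there (here k≡f₂)
  ... | no  k≢f₁ | no  k≢f₂ = there (there (∈-filter⁺ _ k∈ (k≢f₁ , k≢f₂)))
  other : ∀ {k} → k ∈ others → k ∈ edgeList G × k ≢ f₁ × k ≢ f₂
  other = ∈-filter⁻ (λ k → ¬? (k ≟ᵏ f₁) ×-dec ¬? (k ≟ᵏ f₂)) {xs = edgeList G}
  all⊆ : f₁ ∷ f₂ ∷ others ⊆ edgeList G
  all⊆ (here refl)         = f₁∈
  all⊆ (there (here refl)) = f₂∈
  all⊆ (there (there k∈))  = proj₁ (other k∈)
  all-unique : Unique (f₁ ∷ f₂ ∷ others)
  all-unique = (f₁≢f₂ ∷ All.tabulate (λ k∈ → proj₁ (proj₂ (other k∈)) ∘ sym))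
             ∷ All.tabulate (λ k∈ → proj₂ (proj₂ (other k∈)) ∘ sym)
             ∷ Uniqueₚ.filter⁺ _ (edgeList-unique G)
  others<e : suc (length others) ≤ e G ∸ 1
  others<e = subst (suc (length others) ≤_) (pred[m∸n]≡m∸[1+n] (e G) 0) (<⇒≤pred (unique⊆⇒length≤ all-unique all⊆))
  room : ∀ {k} → k ∈ f₁ ∷ f₂ ∷ others → Unique (uncurry L k) × suc (length others) ≤ length (uncurry L k)
  room {i , j} k∈ = let !L , big = L-big i j (proj₁ (∈-edgeList⁻ G (all⊆ k∈))) in !L , ≤-trans others<e big
  open AlmostDistinctChoice (almostDistinctChoice _≟ᵏ_ (uncurry L) f₁ f₂ others room)
  choose-inj-on : ∀ {u v} {Q : Walk (adj G) u v} → Shortest Q →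
                  ∀ {k k′} → k ∈ keys Q → k′ ∈ keys Q → choose k ≡ choose k′ → k ≡ k′
  choose-inj-on {Q = Q} Q-shortest k∈ k′∈ eq with choose-inj (covers (keys⊆edgeList G Q k∈)) (covers (keys⊆edgeList G Q k′∈)) eq
  ... | inj₁ k≡k′                 = k≡k′
  ... | inj₂ (inj₁ (refl , refl)) = ⊥-elim (separated Q-shortest k∈ k′∈)
  ... | inj₂ (inj₂ (refl , refl)) = ⊥-elim (separated Q-shortest k′∈ k∈)
  src : StronglyRainbowConnected G (keyed choose)
  src u v = let Q , Q-shortest = shortest (connected u v) in
    Q , shortest⇒geodesic Q-shortest , keyed-rainbow choose Q (proj₁ Q-shortest) (choose-inj-on Q-shortest)

Sandwiched : ∀ {n} → Graph n → (ℕ → Set) → Set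
Sandwiched G X = (∀ {k} → SRCL G k → X k) × (∀ {k} → X k → RC G k)

module _ {n : ℕ} (G : Graph n) where

  rc-sandwiched : Sandwiched G (RC G)
  rc-sandwiched = SRC⇒RC G ∘ SRCL⇒SRC G , λ rc → rc

  src-sandwiched : Sandwiched G (SRC G)
  src-sandwiched = SRCL⇒SRC G , SRC⇒RC G

  rcl-sandwiched : Sandwiched G (RCL G)
  rcl-sandwiched = SRCL⇒RCL G , RCL⇒RC G

  srcl-sandwiched : Sandwiched G (SRCL G)
  srcl-sandwiched = (λ srcl → srcl) , SRC⇒RC G ∘ SRCL⇒SRC G

IsMin-mono : ∀ {P Q : ℕ → Set} {k l} → (∀ {j} → Q j → P j) → IsMin P k → IsMin Q l → k ≤ l
IsMin-mono Q⇒P (_ , k-min) (Ql , _) = k-min _ (Q⇒P Ql)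

module _ {n : ℕ} (G : Graph n) (2≤n : 2 ≤ n) (connected : Connected G) {X : ℕ → Set} (X-sandwiched : Sandwiched G X) where

  private
    fromSRCL : ∀ {k} → SRCL G k → X k
    fromSRCL = proj₁ X-sandwiched
    toRC : ∀ {k} → X k → RC G k
    toRC = proj₂ X-sandwiched

    1≤ : ∀ {j} → X j → 1 ≤ j
    1≤ {zero}  Xj = contradiction (toRC Xj) (¬RC0 G 2≤n connected)
    1≤ {suc _} _  = s≤s z≤n

  complete⇔isMin1 : Complete G ⇔ IsMin X 1
  complete⇔isMin1 = mk⇔ (λ complete → fromSRCL (Complete⇒SRCL1 G complete) , λ _ → 1≤)
                        (λ (X1 , _) → RC1⇒Complete G (toRC X1))

  isMin2-transfer : ∀ {Y : ℕ → Set} → Sandwiched G Y → (X 2 → Y 2) → IsMin X 2 → IsMin Y 2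
  isMin2-transfer {Y} (_ , Y-toRC) X⇒Y (X2 , X-min) = X⇒Y X2 , Y-min
    where
    Y-min : ∀ j → Y j → 2 ≤ j
    Y-min zero          Yj = contradiction (Y-toRC Yj) (¬RC0 G 2≤n connected)
    Y-min (suc zero)    Yj with X-min 1 (fromSRCL (Complete⇒SRCL1 G (RC1⇒Complete G (Y-toRC Yj))))
    ... | s≤s ()
    Y-min (suc (suc _)) _  = s≤s (s≤s z≤n)

  tree⇔isMin-e : IsTree G ⇔ IsMin X (e G)
  tree⇔isMin-e = mk⇔ tree⇒isMin isMin⇒tree
    where
    tree⇒isMin : IsTree G → IsMin X (e G)
    tree⇒isMin tree = fromSRCL (SRCL-e G connected) , λ j Xj →
      sortedBridges≤ G connected (toRC Xj) (edgeList G) (edgeList-unique G) λ ij∈ →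
        let ij , i<j = ∈-edgeList⁻ G ij∈ in i<j , tree⇒bridge tree ij
    isMin⇒tree : IsMin X (e G) → IsTree G
    isMin⇒tree (_ , X-min) = connected , λ cycle →
      e≰e∸1 (X-min _ (fromSRCL (separated⇒SRCL-e∸1 G connected (cycle⇒separatedEdges G cycle))))
      where
      e≰e∸1 : ¬ e G ≤ e G ∸ 1
      e≰e∸1 with edgeList G | key∈edgeList G (proj₂ (proj₂ (someEdge G 2≤n connected)))
      ... | _ ∷ es | _ = n≮n (length es)

theorem2p1 : ∀ (n : ℕ) (G : Graph n) → 2 ≤ n → Connected G →
  -- (a)
  ((∀ D k → IsDiam G D → rc≡ G k → D ≤ k) ×
   (∀ k k' → rc≡ G k → rcℓ≡ G k' → k ≤ k') × RCL G (n ∸ 1) ×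
   (∀ k s → rc≡ G k → src≡ G s → k ≤ s) ×
   (∀ s s' → src≡ G s → srcℓ≡ G s' → s ≤ s') × SRCL G (e G)) ×
  -- (b)
  (∀ p k → HasBridges G p → rc≡ G k → p ≤ k) ×
  -- (c)
  (∀ (v : Fin n) q s → 2 ≤ q → HasComponents (removeVertex G v) q → src≡ G s → q ≤ s) ×
  -- (d)
  (∀ (w : Fin n) → 3 ≤ n → degree G w ≡ 1 →
     (∀ k k' → rc≡ G k → rc≡ (removeVertex G w) k' → k' ≤ k) ×
     (∀ s s' → src≡ G s → src≡ (removeVertex G w) s' → s' ≤ s)) ×
  -- (e)
  ((Complete G ⇔ IsDiam G 1) × (Complete G ⇔ rc≡ G 1) × (Complete G ⇔ src≡ G 1) ×
   (Complete G ⇔ rcℓ≡ G 1) × (Complete G ⇔ srcℓ≡ G 1)) ×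
  -- (f)
  ((rc≡ G 2 ⇔ src≡ G 2) × (srcℓ≡ G 2 → rcℓ≡ G 2) × (rcℓ≡ G 2 → rc≡ G 2 × src≡ G 2)) ×
  -- (g)
  ((IsTree G ⇔ rc≡ G (e G)) × (IsTree G ⇔ src≡ G (e G)) ×
   (IsTree G ⇔ rcℓ≡ G (e G)) × (IsTree G ⇔ srcℓ≡ G (e G)))
theorem2p1 (suc (suc _)) G 2≤n@(s≤s (s≤s _)) connected =
  ( (λ _ _ diam rc → diam≤rc G diam (proj₁ rc))
  , (λ _ _ → IsMin-mono (RCL⇒RC G))
  , RCL-n∸1 G 2≤n connected
  , (λ _ _ → IsMin-mono (SRC⇒RC G))
  , (λ _ _ → IsMin-mono (SRCL⇒SRC G))
  , SRCL-e G connected )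
  , (λ _ k (bs , !bs , bs≡p , bridges , _) rc → subst (_≤ k) bs≡p (sortedBridges≤ G connected (proj₁ rc) bs !bs bridges))
  , (λ v _ _ _ components src → components≤src G v connected components (proj₁ src))
  , (λ w _ pendant → (λ _ _ rc rc′ → IsMin-mono (RC-removePendant G w pendant) rc′ rc)
                   , (λ _ _ src src′ → IsMin-mono (SRC-removePendant G w pendant) src′ src))
  , ( mk⇔ (Complete⇒Diam1 G 2≤n connected) (Diam1⇒Complete G)
    , complete⇔isMin1 G 2≤n connected (rc-sandwiched G)
    , complete⇔isMin1 G 2≤n connected (src-sandwiched G)
    , complete⇔isMin1 G 2≤n connected (rcl-sandwiched G)
    , complete⇔isMin1 G 2≤n connected (srcl-sandwiched G) )
  , ( mk⇔ (isMin2-transfer G 2≤n connected (rc-sandwiched G) (src-sandwiched G) (RC2⇒SRC2 G))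
          (isMin2-transfer G 2≤n connected (src-sandwiched G) (rc-sandwiched G) (SRC⇒RC G))
    , isMin2-transfer G 2≤n connected (srcl-sandwiched G) (rcl-sandwiched G) (SRCL⇒RCL G)
    , (λ rcl2 → isMin2-transfer G 2≤n connected (rcl-sandwiched G) (rc-sandwiched G) (RCL⇒RC G) rcl2
              , isMin2-transfer G 2≤n connected (rcl-sandwiched G) (src-sandwiched G) (RC2⇒SRC2 G ∘ RCL⇒RC G) rcl2) )
  , ( tree⇔isMin-e G 2≤n connected (rc-sandwiched G)
    , tree⇔isMin-e G 2≤n connected (src-sandwiched G)
    , tree⇔isMin-e G 2≤n connected (rcl-sandwiched G)
    , tree⇔isMin-e G 2≤n connected (srcl-sandwiched G) )
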